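{- Let $f=(A,B,C)$ be a binary quadratic form over $\mathbb{F}_q[t]$ whose discriminant is imaginary or unusual. Then $f$ is equivalent to a partially reduced binary quadratic form of the same discriminant.
   Context: Let $q$ be a power of a prime $p\ge 5$. For nonzero $H\in\mathbb{F}_q[t]$ put $|H|=q^{\deg H}$ (and $|0|=0$), extended to $\mathbb{F}_q(t)$ in the obvious way, and let $\mathrm{sgn}(H)$ denote the leading coefficient of $H$. Fix a primitive root $h$ of $\mathbb{F}_q^*$ and set $S=\{h^i:0\le i\le (q-3)/2\}$, so that for $a\in\mathbb{F}_q^*$, $a\in S$ iff $-a\notin S$. A binary quadratic form $f=(A,B,C)$ is $Ax^2+Bxy+Cy^2$ with $A,B,C\in\mathbb{F}_q[t]$; its discriminant is $D=B^2-4AC$. All forms are assumed primitive, irreducible over $\mathbb{F}_q[t]$, with nonzero discriminant, and $D\notin\mathbb{F}_q$. $D$ is imaginary if $\deg D$ is odd, unusual if $\deg D$ is even and $\mathrm{sgn}(D)$ is a non-square in $\mathbb{F}_q^*$. Discriminants are normalized so that $\mathrm{sgn}(D)\in\{1,h\}$. For $M=\begin{pmatrix}\alpha&\beta\\ \gamma&\delta\end{pmatrix}$, $(f\circ M)(x,y)=f(\alpha x+\beta y,\gamma x+\delta y)$; $f$ and $g$ are equivalent if $g=f\circ M$ for some $M\in GL_2(\mathbb{F}_q[t])$ (entries in $\mathbb{F}_q[t]$, determinant in $\mathbb{F}_q^*$). An imaginary or unusual form $(A,B,C)$ is partially reduced if: (1) $|B|<|A|\le|C|$; (2) if $|A|<|C|$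 then $\mathrm{sgn}(A)\in\{1,h\}$, and if $|A|=|C|$ then $\mathrm{sgn}(A)=1$; (3) $B\neq 0$ implies $\mathrm{sgn}(B)\in S$. -}

module Defs where

open import Level using (0ℓ)
open import Data.Nat as ℕ using (ℕ; zero; suc; _∸_; _^_; _/_)
open import Data.Nat.Primality using (Prime)
open import Data.List using (List; []; _∷_; length; map)
open import Data.List.Membership.Propositional using (_∈_)
open import Data.List.Relation.Unary.Unique.Propositional using (Unique)
open import Data.Product using (Σ; ∃; ∃-syntax; _×_; _,_)
open import Data.Sum using (_⊎_)
open import Data.Empty using (⊥)
open import Relation.Nullary using (¬_; Dec; yes; no)
open import Relation.Binary.PropositionalEquality using (_≡_; _≢_)
open import Algebra.Structures using (IsCommutativeRing)

record FiniteField : Set₁ where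
  infixl 6 _+_
  infixl 7 _*_
  field
    Carrier : Set
    _+_ _*_ : Carrier → Carrier → Carrier
    -_      : Carrier → Carrier
    0# 1#   : Carrier
    isCommutativeRing : IsCommutativeRing _≡_ _+_ _*_ -_ 0# 1#
    0≢1     : 0# ≢ 1#
    inverse : ∀ x → x ≢ 0# → ∃[ y ] (x * y ≡ 1#)
    _≟_     : (x y : Carrier) → Dec (x ≡ y)
    elements : List Carrier
    complete : ∀ x → x ∈ elements
    unique   : Unique elements

  q : ℕ
  q = length elements

  field
    char : ∃[ p ] ∃[ k ] (Prime p × 5 ℕ.≤ p × q ≡ p ^ k)

module FF (F : FiniteField) where
  open FiniteField F public

  pow : Carrier → ℕ → Carrier
  pow x zero    = 1#
  pow x (suc n) = x * pow x n

  IsPrimitiveRoot : Carrier → Set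
  IsPrimitiveRoot h = ∀ x → x ≢ 0# → ∃[ i ] (pow h i ≡ x)

  InS : Carrier → Carrier → Set
  InS h a = ∃[ i ] (i ℕ.≤ (q ∸ 3) / 2 × pow h i ≡ a)

  IsSquare : Carrier → Set
  IsSquare a = ∃[ y ] (y * y ≡ a)

  -- Polynomials in F_q[t]: coefficient lists, constant term first.
  -- Raw lists may have trailing zeros; `norm` strips them, and two
  -- polynomials are equal iff their normalisations coincide.

  Poly : Set
  Poly = List Carrier

  norm : Poly → Poly
  norm [] = []
  norm (x ∷ xs) with norm xs
  ... | y ∷ ys = x ∷ y ∷ ys
  ... | [] with x ≟ 0#
  ...   | yes _ = []
  ...   | no  _ = x ∷ []

  infix 4 _≈ₚ_
  _≈ₚ_ : Poly → Poly → Set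
  P ≈ₚ Q = norm P ≡ norm Q

  const : Carrier → Poly
  const c = c ∷ []

  infixl 6 _⊕_ _⊖_
  infixl 7 _⊗_

  _⊕_ : Poly → Poly → Poly
  [] ⊕ Q = Q
  (a ∷ P) ⊕ [] = a ∷ P
  (a ∷ P) ⊕ (b ∷ Q) = (a + b) ∷ (P ⊕ Q)

  neg : Poly → Poly
  neg P = map -_ P

  _⊖_ : Poly → Poly → Poly
  P ⊖ Q = P ⊕ neg Q

  scale : Carrier → Poly → Poly
  scale c P = map (c *_) P

  _⊗_ : Poly → Poly → Poly
  [] ⊗ Q = []
  (a ∷ P) ⊗ Q = scale a Q ⊕ (0# ∷ (P ⊗ Q))

  -- degree of a nonzero polynomial (deg 0 is irrelevant, set to 0)
  deg : Poly → ℕ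
  deg P = length (norm P) ∸ 1

  -- leading coefficient sgn(H) (for H = 0 the value 0# is irrelevant)
  lastOr : Carrier → List Carrier → Carrier
  lastOr d [] = d
  lastOr d (x ∷ xs) = lastOr x xs

  sgn : Poly → Carrier
  sgn P = lastOr 0# (norm P)

  ∣_∣ : Poly → ℕ
  ∣ P ∣ with norm P
  ... | [] = 0
  ... | _ ∷ _ = q ^ deg P

  _∣ₚ_ : Poly → Poly → Set
  d ∣ₚ P = ∃[ Q ] (P ≈ₚ d ⊗ Q)

  IsUnit : Poly → Set
  IsUnit d = length (norm d) ≡ 1

  -- Binary quadratic forms (A,B,C) = Ax² + Bxy + Cy²

  record Form : Set where
    constructor form
    field
      A B C : Poly
  open Form public

  two four : Carrier
  two  = 1# + 1#
  four = two + two

  disc : Form → Poly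
  disc (form A B C) = (B ⊗ B) ⊖ (scale four (A ⊗ C))

  Primitive : Form → Set
  Primitive (form A B C) =
    ∀ d → d ∣ₚ A → d ∣ₚ B → d ∣ₚ C → IsUnit d

  Irreducible : Form → Set
  Irreducible (form A B C) =
    ¬ (∃[ a ] ∃[ b ] ∃[ c ] ∃[ d ]
         (A ≈ₚ a ⊗ c × B ≈ₚ (a ⊗ d) ⊕ (b ⊗ c) × C ≈ₚ b ⊗ d))

  Imaginary : Poly → Set
  Imaginary D = ∃[ k ] (deg D ≡ suc (2 ℕ.* k))

  Unusual : Poly → Set
  Unusual D = ∃[ k ] (deg D ≡ 2 ℕ.* k) × ¬ IsSquare (sgn D)

  record Mat : Set where
    constructor mat
    field
      α β γ δ : Poly

  det : Mat → Poly
  det (mat α β γ δ) = (α ⊗ δ) ⊖ (β ⊗ γ)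

  InGL2 : Mat → Set
  InGL2 M = ∃[ u ] (u ≢ 0# × det M ≈ₚ const u)

  -- (f ∘ M)(x,y) = f(αx + βy, γx + δy)
  _∘ₘ_ : Form → Mat → Form
  form A B C ∘ₘ mat α β γ δ =
    form ((A ⊗ α ⊗ α) ⊕ (B ⊗ α ⊗ γ) ⊕ (C ⊗ γ ⊗ γ))
         (scale two (A ⊗ α ⊗ β) ⊕ (B ⊗ ((α ⊗ δ) ⊕ (β ⊗ γ))) ⊕ scale two (C ⊗ γ ⊗ δ))
         ((A ⊗ β ⊗ β) ⊕ (B ⊗ β ⊗ δ) ⊕ (C ⊗ δ ⊗ δ))

  PartiallyReduced : Carrier → Form → Set
  PartiallyReduced h (form A B C) =
      (∣ B ∣ ℕ.< ∣ A ∣ × ∣ A ∣ ℕ.≤ ∣ C ∣)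
    × (∣ A ∣ ℕ.< ∣ C ∣ → sgn A ≡ 1# ⊎ sgn A ≡ h)
    × (∣ A ∣ ≡ ∣ C ∣ → sgn A ≡ 1#)
    × (¬ (B ≈ₚ []) → InS h (sgn B))

module Submission where

-- Transformations by matrices of determinant ±1 keep D = B² - 4AC. Translating
-- x ↦ x + ky reduces B modulo 2A and swapping x, y exchanges A and C; alternating the
-- two lowers deg A until deg B < deg A ≤ deg C. Since D is imaginary or unusual, its
-- leading term is then -4 lc(A) lc(C) t^(deg A + deg C), and A, C never vanish. If
-- deg A < deg C, rescaling x makes lc(A) ∈ {1, h}, as every unit is w² or h w². If
-- deg A = deg C, then -lc(A) lc(C) is a non-square, so lc(A) α² + lc(C) γ² = 1 is
-- solvable; a unimodular substitution with first column (α, γ) makes lc(A) = 1, and one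
-- more translation restores deg B < deg A (deg C cannot drop below deg A, or deg D
-- would). Finally y ↦ -y puts lc(B) into S.

open import Defs
open import Level using (0ℓ)
open import Data.Nat as ℕ using (ℕ; zero; suc; z≤n; s≤s; _≤_; _∸_; _^_; NonZero)
import Data.Nat.Properties as ℕₚ
open import Data.List using (List; []; _∷_; length; lookup)
open import Data.List.Relation.Unary.All using (All; _∷_)
open import Data.List.Relation.Unary.AllPairs using (_∷_)
import Data.List.Relation.Unary.Any as Any
import Data.List.Membership.Setoid.Properties as Membershipₚ
open import Data.List.Relation.Unary.Unique.Propositional using (Unique)
open import Data.Fin as Fin using (Fin; toℕ; fromℕ<)
import Data.Fin.Properties as Finₚ
open import Data.Nat.DivMod using (_%_; _/_; m≡m%n+[m/n]*n; m%n<n; m*n/n≡m)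
open import Data.Nat.Divisibility using (m%n≡0⇒n∣m)
open import Data.Nat.Primality using (Prime; prime⇒nonZero; prime⇒¬composite; composite-≢)
import Data.Nat.Solver as ℕSolver
open import Data.Product using (∃-syntax; _×_; _,_; proj₁; proj₂)
open import Data.Sum using (_⊎_; inj₁; inj₂)
import Data.Sum
open import Data.Empty using (⊥-elim)
open import Relation.Nullary using (¬_; Dec; yes; no)
open import Relation.Binary.PropositionalEquality
open import Relation.Binary.Bundles using (Setoid)
open import Relation.Binary.Definitions using (tri<; tri≈; tri>)
import Relation.Binary.Reasoning.Setoid as SetoidReasoning
open import Algebra.Bundles using (CommutativeRing)
import Algebra.Properties.Ring as RingProperties
import Algebra.Solver.Ring.NaturalCoefficients.Default as NaturalSolver

-- The natural-coefficient ring solver does not handle negation; these lemmas reduce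
-- identities involving subtraction to negation-free ones.
module Differences {c ℓ} (R : CommutativeRing c ℓ) where
  open CommutativeRing R renaming (refl to ≈-refl; sym to ≈-sym; trans to ≈-trans; setoid to ≈-setoid)
  open RingProperties ring using (-‿distribˡ-*; -‿distribʳ-*; -‿involutive; -‿+-comm)
  open SetoidReasoning ≈-setoid
  open NaturalSolver commutativeSemiring using (solve; _:=_; _:+_; _:*_)

  -‿cross : ∀ x y x′ y′ → x + y′ ≈ x′ + y → x - y ≈ x′ - y′
  -‿cross x y x′ y′ e = begin
    x - y                    ≈⟨ +-identityʳ (x - y) ⟨
    (x - y) + 0#             ≈⟨ +-congˡ (-‿inverseʳ y′) ⟨
    (x - y) + (y′ - y′)      ≈⟨ solve 4 (λ x y′ -y -y′ → ((x :+ -y) :+ (y′ :+ -y′)) := ((x :+ y′) :+ (-y′ :+ -y))) ≈-refl x y′ (- y) (- y′) ⟩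
    (x + y′) + (- y′ - y)    ≈⟨ +-congʳ e ⟩
    (x′ + y) + (- y′ - y)    ≈⟨ solve 4 (λ x′ y -y -y′ → ((x′ :+ y) :+ (-y′ :+ -y)) := ((x′ :+ -y′) :+ (y :+ -y))) ≈-refl x′ y (- y) (- y′) ⟩
    (x′ - y′) + (y - y)      ≈⟨ +-congˡ (-‿inverseʳ y) ⟩
    (x′ - y′) + 0#           ≈⟨ +-identityʳ (x′ - y′) ⟩
    x′ - y′                  ∎

  *-difference-of-squares : ∀ x y → (x + y) * (x - y) ≈ x * x - y * y
  *-difference-of-squares x y = begin
    (x + y) * (x - y)                  ≈⟨ solve 3 (λ x y -y → ((x :+ y) :* (x :+ -y)) := (((x :* x) :+ (y :* -y)) :+ (x :* (y :+ -y)))) ≈-refl x y (- y) ⟩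
    (x * x + y * - y) + x * (y - y)    ≈⟨ +-cong (+-congˡ (≈-sym (-‿distribʳ-* y y))) (≈-trans (*-congˡ (-‿inverseʳ y)) (zeroʳ x)) ⟩
    (x * x - y * y) + 0#               ≈⟨ +-identityʳ _ ⟩
    x * x - y * y                      ∎

  *-distrib-- : ∀ a b c d → (a - b) * (c - d) ≈ (a * c + b * d) - (a * d + b * c)
  *-distrib-- a b c d = begin
    (a - b) * (c - d)                              ≈⟨ solve 4 (λ a -b c -d → ((a :+ -b) :* (c :+ -d)) := (((a :* c) :+ (-b :* -d)) :+ ((a :* -d) :+ (-b :* c)))) ≈-refl a (- b) c (- d) ⟩
    (a * c + - b * - d) + (a * - d + - b * c)      ≈⟨ +-cong (+-congˡ -b*-d≈b*d) (+-cong (≈-sym (-‿distribʳ-* a d)) (≈-sym (-‿distribˡ-* b c))) ⟩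
    (a * c + b * d) + (- (a * d) + - (b * c))      ≈⟨ +-congˡ (-‿+-comm (a * d) (b * c)) ⟩
    (a * c + b * d) - (a * d + b * c)              ∎
    where
    -b*-d≈b*d : - b * - d ≈ b * d
    -b*-d≈b*d = ≈-trans (≈-sym (-‿distribˡ-* b (- d))) (≈-trans (-‿cong (≈-sym (-‿distribʳ-* b d))) (-‿involutive (b * d)))

-- The coefficients of A x² + B xy + C y² after substituting x ↦ αx + βy, y ↦ γx + δy,
-- written over an arbitrary carrier so that the same terms can be handed to the ring solver.
module Substitution {X : Set} (_+_ _*_ : X → X → X) where
  A′ B′ C′ : (A B C α β γ δ : X) → X
  A′ A B C α β γ δ = (((A * α) * α) + ((B * α) * γ)) + ((C * γ) * γ)
  B′ A B C α β γ δ =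
    ((((A * α) * β) + ((A * α) * β)) + (B * ((α * δ) + (β * γ)))) + (((C * γ) * δ) + ((C * γ) * δ))
  C′ A B C α β γ δ = (((A * β) * β) + ((B * β) * δ)) + ((C * δ) * δ)

  twice once : (X → X → X → X → X → X → X → X) → (A B C α β γ δ α′ β′ γ′ δ′ : X) → X
  twice K A B C α β γ δ α′ β′ γ′ δ′ =
    K (A′ A B C α β γ δ) (B′ A B C α β γ δ) (C′ A B C α β γ δ) α′ β′ γ′ δ′
  once K A B C α β γ δ α′ β′ γ′ δ′ =
    K A B C ((α * α′) + (β * γ′)) ((α * β′) + (β * δ′)) ((γ * α′) + (δ * γ′)) ((γ * β′) + (δ * δ′))

module _ (F : FiniteField) where
  open FF F

  -- Arithmetic in F_q

  fieldRing : CommutativeRing 0ℓ 0ℓ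
  fieldRing = record { isCommutativeRing = isCommutativeRing }

  open CommutativeRing fieldRing using
    (+-assoc; +-comm; +-identityˡ; +-identityʳ; -‿inverseʳ; -‿inverseˡ;
     *-assoc; *-comm; *-identityˡ; *-identityʳ; distribˡ; distribʳ; zeroˡ; zeroʳ)

  open RingProperties (CommutativeRing.ring fieldRing) using
    (-0#≈0#; -‿involutive; -‿distribʳ-*; -‿distribˡ-*; -‿injective; -1*x≈-x;
     x∙y⁻¹≈ε⇒x≈y; +-inverseˡ-unique; +-cancelˡ)

  module FieldSolver = NaturalSolver (CommutativeRing.commutativeSemiring fieldRing)

  inv : ∀ x → x ≢ 0# → Carrier
  inv x x≢0 = proj₁ (inverse x x≢0)

  *-inverseʳ : ∀ x (x≢0 : x ≢ 0#) → x * inv x x≢0 ≡ 1#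
  *-inverseʳ x x≢0 = proj₂ (inverse x x≢0)

  *-inverseˡ : ∀ x (x≢0 : x ≢ 0#) → inv x x≢0 * x ≡ 1#
  *-inverseˡ x x≢0 = trans (*-comm _ x) (*-inverseʳ x x≢0)

  inv-nonzero : ∀ x (x≢0 : x ≢ 0#) → inv x x≢0 ≢ 0#
  inv-nonzero x x≢0 x⁻¹≡0 = 0≢1 (trans (sym (zeroˡ x)) (trans (cong (_* x) (sym x⁻¹≡0)) (*-inverseˡ x x≢0)))

  *-cancelˡ : ∀ {x y z} → x ≢ 0# → x * y ≡ x * z → y ≡ z
  *-cancelˡ {x} {y} {z} x≢0 e = begin
    y                  ≡⟨ *-identityˡ y ⟨
    1# * y             ≡⟨ cong (_* y) (*-inverseˡ x x≢0) ⟨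
    (x⁻¹ * x) * y      ≡⟨ *-assoc _ x y ⟩
    x⁻¹ * (x * y)      ≡⟨ cong (x⁻¹ *_) e ⟩
    x⁻¹ * (x * z)      ≡⟨ *-assoc _ x z ⟨
    (x⁻¹ * x) * z      ≡⟨ cong (_* z) (*-inverseˡ x x≢0) ⟩
    1# * z             ≡⟨ *-identityˡ z ⟩
    z                  ∎
    where
    open ≡-Reasoning
    x⁻¹ = inv x x≢0

  *-nonzero : ∀ {x y} → x ≢ 0# → y ≢ 0# → x * y ≢ 0#
  *-nonzero {x} {y} x≢0 y≢0 xy≡0 = y≢0 (*-cancelˡ x≢0 (trans xy≡0 (sym (zeroʳ x))))

  -1·-1≡1 : - 1# * - 1# ≡ 1#
  -1·-1≡1 = trans (-1*x≈-x (- 1#)) (-‿involutive 1#)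

  open Differences fieldRing using (*-difference-of-squares)

  square≡1 : ∀ x → x * x ≡ 1# → x ≡ 1# ⊎ x ≡ - 1#
  square≡1 x x²≡1 with (x + 1#) ≟ 0#
  ... | yes x+1≡0 = inj₂ (+-inverseˡ-unique x 1# x+1≡0)
  ... | no  x+1≢0 = inj₁ (x∙y⁻¹≈ε⇒x≈y x 1# (*-cancelˡ x+1≢0 (begin
    (x + 1#) * (x + - 1#)  ≡⟨ *-difference-of-squares x 1# ⟩
    x * x + - (1# * 1#)    ≡⟨ cong₂ (λ a b → a + - b) x²≡1 (*-identityˡ 1#) ⟩
    1# + - 1#              ≡⟨ -‿inverseʳ 1# ⟩
    0#                     ≡⟨ zeroʳ (x + 1#) ⟨
    (x + 1#) * 0#          ∎)))
    where open ≡-Reasoning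

  [xx][yy]≡[xy][xy] : ∀ x y → (x * x) * (y * y) ≡ (x * y) * (x * y)
  [xx][yy]≡[xy][xy] = solve 2 (λ x y → ((x :* x) :* (y :* y)) := ((x :* y) :* (x :* y))) refl
    where open FieldSolver using (solve; _:=_; _:*_)

  [x⁻¹x⁻¹][xx]≡1 : ∀ x (x≢0 : x ≢ 0#) → (inv x x≢0 * inv x x≢0) * (x * x) ≡ 1#
  [x⁻¹x⁻¹][xx]≡1 x x≢0 = begin
    (x⁻¹ * x⁻¹) * (x * x)   ≡⟨ [xx][yy]≡[xy][xy] x⁻¹ x ⟩
    (x⁻¹ * x) * (x⁻¹ * x)   ≡⟨ cong₂ _*_ (*-inverseˡ x x≢0) (*-inverseˡ x x≢0) ⟩
    1# * 1#                 ≡⟨ *-identityˡ 1# ⟩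
    1#                      ∎
    where
    open ≡-Reasoning
    x⁻¹ = inv x x≢0

  four≡two·two : four ≡ two * two
  four≡two·two = sym (trans (distribˡ two 1# 1#) (cong₂ _+_ (*-identityʳ two) (*-identityʳ two)))

  -4x-nonsquare⇒-x-nonsquare : ∀ {x} → ¬ IsSquare (- (four * x)) → ¬ IsSquare (- x)
  -4x-nonsquare⇒-x-nonsquare {x} nonsquare (y , y²≡-x) = nonsquare (two * y , (begin
    (two * y) * (two * y)   ≡⟨ [xx][yy]≡[xy][xy] two y ⟨
    (two * two) * (y * y)   ≡⟨ cong₂ _*_ (sym four≡two·two) y²≡-x ⟩
    four * - x              ≡⟨ -‿distribʳ-* four x ⟨
    - (four * x)            ∎))
    where open ≡-Reasoning

  rescale-to-one : ∀ {a c α γ u} (u≢0 : u ≢ 0#) → (α * α) * a + (γ * γ) * c ≡ u * u →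
    let u⁻¹ = inv u u≢0 in ((α * u⁻¹) * (α * u⁻¹)) * a + ((γ * u⁻¹) * (γ * u⁻¹)) * c ≡ 1#
  rescale-to-one {a} {c} {α} {γ} {u} u≢0 rep = begin
    ((α * u⁻¹) * (α * u⁻¹)) * a + ((γ * u⁻¹) * (γ * u⁻¹)) * c
      ≡⟨ solve 5 (λ α γ u⁻¹ a c → ((((α :* u⁻¹) :* (α :* u⁻¹)) :* a) :+ (((γ :* u⁻¹) :* (γ :* u⁻¹)) :* c))
                                 := ((u⁻¹ :* u⁻¹) :* (((α :* α) :* a) :+ ((γ :* γ) :* c)))) refl α γ u⁻¹ a c ⟩
    (u⁻¹ * u⁻¹) * ((α * α) * a + (γ * γ) * c)
      ≡⟨ cong ((u⁻¹ * u⁻¹) *_) rep ⟩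
    (u⁻¹ * u⁻¹) * (u * u)
      ≡⟨ [x⁻¹x⁻¹][xx]≡1 u u≢0 ⟩
    1# ∎
    where
    open ≡-Reasoning
    open FieldSolver using (solve; _:=_; _:+_; _:*_)
    u⁻¹ = inv u u≢0

  represents-one⇒nonzero : ∀ {a c} α γ → (α * α) * a + (γ * γ) * c ≡ 1# → α ≢ 0# ⊎ γ ≢ 0#
  represents-one⇒nonzero α γ rep with α ≟ 0# | γ ≟ 0#
  ... | no  α≢0 | _        = inj₁ α≢0
  ... | yes _   | no  γ≢0  = inj₂ γ≢0
  ... | yes refl | yes refl = ⊥-elim (0≢1 (trans (sym 0·0-terms≡0) rep))
    where
    0·0-terms≡0 : (0# * 0#) * _ + (0# * 0#) * _ ≡ 0#
    0·0-terms≡0 = trans (cong₂ _+_ (trans (cong (_* _) (zeroˡ 0#)) (zeroˡ _)) (trans (cong (_* _) (zeroˡ 0#)) (zeroˡ _))) (+-identityˡ 0#)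

  unimodular-completion : ∀ α γ → α ≢ 0# ⊎ γ ≢ 0# → ∃[ β ] ∃[ δ ] (α * δ + - (β * γ) ≡ 1#)
  unimodular-completion α γ (inj₁ α≢0) = 0# , inv α α≢0 , (begin
    α * inv α α≢0 + - (0# * γ)   ≡⟨ cong₂ (λ x y → x + - y) (*-inverseʳ α α≢0) (zeroˡ γ) ⟩
    1# + - 0#                    ≡⟨ cong (1# +_) -0#≈0# ⟩
    1# + 0#                      ≡⟨ +-identityʳ 1# ⟩
    1#                           ∎)
    where open ≡-Reasoning
  unimodular-completion α γ (inj₂ γ≢0) = - γ⁻¹ , 0# , (begin
    α * 0# + - (- γ⁻¹ * γ)   ≡⟨ cong₂ (λ x y → x + - y) (zeroʳ α) (sym (-‿distribˡ-* γ⁻¹ γ)) ⟩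
    0# + - (- (γ⁻¹ * γ))     ≡⟨ +-identityˡ _ ⟩
    - (- (γ⁻¹ * γ))          ≡⟨ -‿involutive _ ⟩
    γ⁻¹ * γ                  ≡⟨ *-inverseˡ γ γ≢0 ⟩
    1#                       ∎)
    where
    open ≡-Reasoning
    γ⁻¹ = inv γ γ≢0

  -- Polynomials up to trailing zeros

  coeff : Poly → ℕ → Carrier
  coeff []       n       = 0#
  coeff (x ∷ xs) zero    = x
  coeff (x ∷ xs) (suc n) = coeff xs n

  infix 4 _≋_
  record _≋_ (P Q : Poly) : Set where
    constructor mk≋
    field at : ∀ n → coeff P n ≡ coeff Q n

  open _≋_ public

  ≋-refl : ∀ {P} → P ≋ P
  ≋-refl = mk≋ λ n → refl

  ≋-sym : ∀ {P Q} → P ≋ Q → Q ≋ P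
  ≋-sym p = mk≋ λ n → sym (at p n)

  ≋-trans : ∀ {P Q R} → P ≋ Q → Q ≋ R → P ≋ R
  ≋-trans p r = mk≋ λ n → trans (at p n) (at r n)

  ≋-setoid : Setoid 0ℓ 0ℓ
  ≋-setoid = record
    { Carrier = Poly ; _≈_ = _≋_
    ; isEquivalence = record { refl = ≋-refl ; sym = ≋-sym ; trans = ≋-trans } }

  module ≋-Reasoning = SetoidReasoning ≋-setoid

  ≋-tail : ∀ {a b P Q} → (a ∷ P) ≋ (b ∷ Q) → P ≋ Q
  ≋-tail e = mk≋ λ n → at e (suc n)

  ∷≋[]-tail : ∀ {a P} → (a ∷ P) ≋ [] → P ≋ []
  ∷≋[]-tail e = mk≋ λ n → at e (suc n)

  ∷-cong : ∀ {a b P Q} → a ≡ b → P ≋ Q → (a ∷ P) ≋ (b ∷ Q)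
  ∷-cong {a} {b} {P} {Q} a≡b P≋Q = mk≋ pointwise
    where
    pointwise : ∀ n → coeff (a ∷ P) n ≡ coeff (b ∷ Q) n
    pointwise zero    = a≡b
    pointwise (suc n) = at P≋Q n

  0∷-≋[] : ∀ {P} → P ≋ [] → (0# ∷ P) ≋ []
  0∷-≋[] P≋0 = mk≋ λ { zero → refl ; (suc n) → at P≋0 n }

  coeff-⊕ : ∀ P Q n → coeff (P ⊕ Q) n ≡ coeff P n + coeff Q n
  coeff-⊕ []      Q       n       = sym (+-identityˡ _)
  coeff-⊕ (a ∷ P) []      n       = sym (+-identityʳ _)
  coeff-⊕ (a ∷ P) (b ∷ Q) zero    = refl
  coeff-⊕ (a ∷ P) (b ∷ Q) (suc n) = coeff-⊕ P Q n

  coeff-scale : ∀ c P n → coeff (scale c P) n ≡ c * coeff P n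
  coeff-scale c []      n       = sym (zeroʳ c)
  coeff-scale c (a ∷ P) zero    = refl
  coeff-scale c (a ∷ P) (suc n) = coeff-scale c P n

  coeff-neg : ∀ P n → coeff (neg P) n ≡ - coeff P n
  coeff-neg []      n       = sym -0#≈0#
  coeff-neg (a ∷ P) zero    = refl
  coeff-neg (a ∷ P) (suc n) = coeff-neg P n

  ⊕-cong : ∀ {P P′ Q Q′} → P ≋ P′ → Q ≋ Q′ → P ⊕ Q ≋ P′ ⊕ Q′
  ⊕-cong {P} {P′} {Q} {Q′} p q = mk≋ λ n → begin
    coeff (P ⊕ Q) n           ≡⟨ coeff-⊕ P Q n ⟩
    coeff P n + coeff Q n     ≡⟨ cong₂ _+_ (at p n) (at q n) ⟩
    coeff P′ n + coeff Q′ n   ≡⟨ coeff-⊕ P′ Q′ n ⟨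
    coeff (P′ ⊕ Q′) n         ∎
    where open ≡-Reasoning

  scale-cong : ∀ {c d P Q} → c ≡ d → P ≋ Q → scale c P ≋ scale d Q
  scale-cong {c} {d} {P} {Q} c≡d p = mk≋ λ n → begin
    coeff (scale c P) n  ≡⟨ coeff-scale c P n ⟩
    c * coeff P n        ≡⟨ cong₂ _*_ c≡d (at p n) ⟩
    d * coeff Q n        ≡⟨ coeff-scale d Q n ⟨
    coeff (scale d Q) n  ∎
    where open ≡-Reasoning

  neg-cong : ∀ {P Q} → P ≋ Q → neg P ≋ neg Q
  neg-cong {P} {Q} p = mk≋ λ n →
    trans (coeff-neg P n) (trans (cong -_ (at p n)) (sym (coeff-neg Q n)))

  ⊕-assoc : ∀ P Q R → (P ⊕ Q) ⊕ R ≋ P ⊕ (Q ⊕ R)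
  ⊕-assoc P Q R = mk≋ λ n → begin
    coeff ((P ⊕ Q) ⊕ R) n                ≡⟨ coeff-⊕ (P ⊕ Q) R n ⟩
    coeff (P ⊕ Q) n + coeff R n          ≡⟨ cong (_+ coeff R n) (coeff-⊕ P Q n) ⟩
    (coeff P n + coeff Q n) + coeff R n  ≡⟨ +-assoc _ _ _ ⟩
    coeff P n + (coeff Q n + coeff R n)  ≡⟨ cong (coeff P n +_) (coeff-⊕ Q R n) ⟨
    coeff P n + coeff (Q ⊕ R) n          ≡⟨ coeff-⊕ P (Q ⊕ R) n ⟨
    coeff (P ⊕ (Q ⊕ R)) n                ∎
    where open ≡-Reasoning

  ⊕-comm : ∀ P Q → P ⊕ Q ≋ Q ⊕ P
  ⊕-comm P Q = mk≋ λ n →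
    trans (coeff-⊕ P Q n) (trans (+-comm _ _) (sym (coeff-⊕ Q P n)))

  ⊕-identityʳ : ∀ P → P ⊕ [] ≋ P
  ⊕-identityʳ P = mk≋ λ n → trans (coeff-⊕ P [] n) (+-identityʳ _)

  ⊕-inverseʳ : ∀ P → P ⊕ neg P ≋ []
  ⊕-inverseʳ P = mk≋ λ n →
    trans (coeff-⊕ P (neg P) n) (trans (cong (coeff P n +_) (coeff-neg P n)) (-‿inverseʳ _))

  ⊕-inverseˡ : ∀ P → neg P ⊕ P ≋ []
  ⊕-inverseˡ P = ≋-trans (⊕-comm (neg P) P) (⊕-inverseʳ P)

  scale-distribˡ : ∀ a b Q → scale (a + b) Q ≋ scale a Q ⊕ scale b Q
  scale-distribˡ a b Q = mk≋ λ n → begin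
    coeff (scale (a + b) Q) n                    ≡⟨ coeff-scale (a + b) Q n ⟩
    (a + b) * coeff Q n                          ≡⟨ distribʳ _ a b ⟩
    a * coeff Q n + b * coeff Q n                ≡⟨ cong₂ _+_ (coeff-scale a Q n) (coeff-scale b Q n) ⟨
    coeff (scale a Q) n + coeff (scale b Q) n    ≡⟨ coeff-⊕ (scale a Q) (scale b Q) n ⟨
    coeff (scale a Q ⊕ scale b Q) n              ∎
    where open ≡-Reasoning

  scale-distribʳ : ∀ c P Q → scale c (P ⊕ Q) ≋ scale c P ⊕ scale c Q
  scale-distribʳ c P Q = mk≋ λ n → begin
    coeff (scale c (P ⊕ Q)) n                    ≡⟨ coeff-scale c (P ⊕ Q) n ⟩
    c * coeff (P ⊕ Q) n                          ≡⟨ cong (c *_) (coeff-⊕ P Q n) ⟩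
    c * (coeff P n + coeff Q n)                  ≡⟨ distribˡ c _ _ ⟩
    c * coeff P n + c * coeff Q n                ≡⟨ cong₂ _+_ (coeff-scale c P n) (coeff-scale c Q n) ⟨
    coeff (scale c P) n + coeff (scale c Q) n    ≡⟨ coeff-⊕ (scale c P) (scale c Q) n ⟨
    coeff (scale c P ⊕ scale c Q) n              ∎
    where open ≡-Reasoning

  scale-scale : ∀ c a Q → scale c (scale a Q) ≋ scale (c * a) Q
  scale-scale c a Q = mk≋ λ n → begin
    coeff (scale c (scale a Q)) n  ≡⟨ coeff-scale c (scale a Q) n ⟩
    c * coeff (scale a Q) n        ≡⟨ cong (c *_) (coeff-scale a Q n) ⟩
    c * (a * coeff Q n)            ≡⟨ *-assoc c a _ ⟨
    (c * a) * coeff Q n            ≡⟨ coeff-scale (c * a) Q n ⟨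
    coeff (scale (c * a) Q) n      ∎
    where open ≡-Reasoning

  scale-identity : ∀ Q → scale 1# Q ≋ Q
  scale-identity Q = mk≋ λ n → trans (coeff-scale 1# Q n) (*-identityˡ _)

  scale-zero : ∀ Q → scale 0# Q ≋ []
  scale-zero Q = mk≋ λ n → trans (coeff-scale 0# Q n) (zeroˡ _)

  scale-≡1 : ∀ {c} P → c ≡ 1# → scale c P ≋ P
  scale-≡1 P refl = scale-identity P

  scale-≡-1 : ∀ {c} P → c ≡ - 1# → scale c P ≋ neg P
  scale-≡-1 P refl = mk≋ λ n → trans (coeff-scale (- 1#) P n) (trans (-1*x≈-x (coeff P n)) (sym (coeff-neg P n)))

  ⊕-interchange : ∀ P Q R S → (P ⊕ Q) ⊕ (R ⊕ S) ≋ (P ⊕ R) ⊕ (Q ⊕ S)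
  ⊕-interchange P Q R S = begin
    (P ⊕ Q) ⊕ (R ⊕ S)  ≈⟨ ⊕-assoc P Q (R ⊕ S) ⟩
    P ⊕ (Q ⊕ (R ⊕ S))  ≈⟨ ⊕-cong (≋-refl {P}) (⊕-assoc Q R S) ⟨
    P ⊕ ((Q ⊕ R) ⊕ S)  ≈⟨ ⊕-cong (≋-refl {P}) (⊕-cong (⊕-comm Q R) (≋-refl {S})) ⟩
    P ⊕ ((R ⊕ Q) ⊕ S)  ≈⟨ ⊕-cong (≋-refl {P}) (⊕-assoc R Q S) ⟩
    P ⊕ (R ⊕ (Q ⊕ S))  ≈⟨ ⊕-assoc P R (Q ⊕ S) ⟨
    (P ⊕ R) ⊕ (Q ⊕ S)  ∎
    where open ≋-Reasoning

  ⊗-congʳ : ∀ P {Q Q′} → Q ≋ Q′ → P ⊗ Q ≋ P ⊗ Q′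
  ⊗-congʳ []      q = ≋-refl
  ⊗-congʳ (a ∷ P) q = ⊕-cong (scale-cong refl q) (∷-cong refl (⊗-congʳ P q))

  ⊗-zeroˡ : ∀ {P} Q → P ≋ [] → P ⊗ Q ≋ []
  ⊗-zeroˡ {[]}    Q p = ≋-refl
  ⊗-zeroˡ {a ∷ P} Q p = begin
    scale a Q ⊕ (0# ∷ (P ⊗ Q))  ≈⟨ ⊕-cong (scale-cong (at p 0) (≋-refl {Q})) (0∷-≋[] (⊗-zeroˡ Q (∷≋[]-tail p))) ⟩
    scale 0# Q ⊕ []             ≈⟨ ⊕-identityʳ (scale 0# Q) ⟩
    scale 0# Q                  ≈⟨ scale-zero Q ⟩
    []                          ∎
    where open ≋-Reasoning

  ⊗-congˡ : ∀ {P P′} Q → P ≋ P′ → P ⊗ Q ≋ P′ ⊗ Q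
  ⊗-congˡ {[]}    {P′}     Q p = ≋-sym (⊗-zeroˡ Q (≋-sym p))
  ⊗-congˡ {a ∷ P} {[]}     Q p = ⊗-zeroˡ Q p
  ⊗-congˡ {a ∷ P} {b ∷ P′} Q p =
    ⊕-cong (scale-cong (at p 0) (≋-refl {Q})) (∷-cong refl (⊗-congˡ Q (≋-tail p)))

  ⊗-cong : ∀ {P P′ Q Q′} → P ≋ P′ → Q ≋ Q′ → P ⊗ Q ≋ P′ ⊗ Q′
  ⊗-cong {P′ = P′} {Q = Q} p q = ≋-trans (⊗-congˡ Q p) (⊗-congʳ P′ q)

  ⊗-zeroʳ : ∀ P → P ⊗ [] ≋ []
  ⊗-zeroʳ []      = ≋-refl
  ⊗-zeroʳ (a ∷ P) = 0∷-≋[] (⊗-zeroʳ P)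

  0∷-⊗ : ∀ P Q → (0# ∷ P) ⊗ Q ≋ 0# ∷ (P ⊗ Q)
  0∷-⊗ P Q = begin
    scale 0# Q ⊕ (0# ∷ (P ⊗ Q))  ≈⟨ ⊕-cong (scale-zero Q) (≋-refl {0# ∷ (P ⊗ Q)}) ⟩
    0# ∷ (P ⊗ Q)                 ∎
    where open ≋-Reasoning

  ⊗-distribʳ-⊕ : ∀ P P′ Q → (P ⊕ P′) ⊗ Q ≋ (P ⊗ Q) ⊕ (P′ ⊗ Q)
  ⊗-distribʳ-⊕ []      P′       Q = ≋-refl
  ⊗-distribʳ-⊕ (a ∷ P) []       Q = ≋-sym (⊕-identityʳ _)
  ⊗-distribʳ-⊕ (a ∷ P) (b ∷ P′) Q = begin
    scale (a + b) Q ⊕ (0# ∷ ((P ⊕ P′) ⊗ Q))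
      ≈⟨ ⊕-cong (scale-distribˡ a b Q) (∷-cong (sym (+-identityʳ 0#)) (⊗-distribʳ-⊕ P P′ Q)) ⟩
    (scale a Q ⊕ scale b Q) ⊕ ((0# ∷ (P ⊗ Q)) ⊕ (0# ∷ (P′ ⊗ Q)))
      ≈⟨ ⊕-interchange (scale a Q) _ _ _ ⟩
    (scale a Q ⊕ (0# ∷ (P ⊗ Q))) ⊕ (scale b Q ⊕ (0# ∷ (P′ ⊗ Q)))  ∎
    where open ≋-Reasoning

  scale-⊗ : ∀ c P Q → scale c P ⊗ Q ≋ scale c (P ⊗ Q)
  scale-⊗ c []      Q = ≋-refl
  scale-⊗ c (a ∷ P) Q = begin
    scale (c * a) Q ⊕ (0# ∷ (scale c P ⊗ Q))
      ≈⟨ ⊕-cong (≋-sym (scale-scale c a Q)) (∷-cong (sym (zeroʳ c)) (scale-⊗ c P Q)) ⟩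
    scale c (scale a Q) ⊕ scale c (0# ∷ (P ⊗ Q))
      ≈⟨ scale-distribʳ c (scale a Q) (0# ∷ (P ⊗ Q)) ⟨
    scale c (scale a Q ⊕ (0# ∷ (P ⊗ Q)))  ∎
    where open ≋-Reasoning

  ⊗-∷ʳ : ∀ P b Q → P ⊗ (b ∷ Q) ≋ scale b P ⊕ (0# ∷ (P ⊗ Q))
  ⊗-∷ʳ []      b Q = ≋-sym (0∷-≋[] ≋-refl)
  ⊗-∷ʳ (a ∷ P) b Q = ∷-cong (cong (_+ 0#) (*-comm a b)) (begin
    scale a Q ⊕ (P ⊗ (b ∷ Q))                    ≈⟨ ⊕-cong (≋-refl {scale a Q}) (⊗-∷ʳ P b Q) ⟩
    scale a Q ⊕ (scale b P ⊕ (0# ∷ (P ⊗ Q)))     ≈⟨ ⊕-assoc (scale a Q) _ _ ⟨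
    (scale a Q ⊕ scale b P) ⊕ (0# ∷ (P ⊗ Q))     ≈⟨ ⊕-cong (⊕-comm (scale a Q) (scale b P)) ≋-refl ⟩
    (scale b P ⊕ scale a Q) ⊕ (0# ∷ (P ⊗ Q))     ≈⟨ ⊕-assoc (scale b P) _ _ ⟩
    scale b P ⊕ (scale a Q ⊕ (0# ∷ (P ⊗ Q)))     ∎)
    where open ≋-Reasoning

  ⊗-comm : ∀ P Q → P ⊗ Q ≋ Q ⊗ P
  ⊗-comm []      Q = ≋-sym (⊗-zeroʳ Q)
  ⊗-comm (a ∷ P) Q =
    ≋-trans (⊕-cong (≋-refl {scale a Q}) (∷-cong refl (⊗-comm P Q))) (≋-sym (⊗-∷ʳ Q a P))

  ⊗-assoc : ∀ P Q R → (P ⊗ Q) ⊗ R ≋ P ⊗ (Q ⊗ R)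
  ⊗-assoc []      Q R = ≋-refl
  ⊗-assoc (a ∷ P) Q R = begin
    (scale a Q ⊕ (0# ∷ (P ⊗ Q))) ⊗ R             ≈⟨ ⊗-distribʳ-⊕ (scale a Q) _ R ⟩
    (scale a Q ⊗ R) ⊕ ((0# ∷ (P ⊗ Q)) ⊗ R)       ≈⟨ ⊕-cong (scale-⊗ a Q R) (0∷-⊗ (P ⊗ Q) R) ⟩
    scale a (Q ⊗ R) ⊕ (0# ∷ ((P ⊗ Q) ⊗ R))       ≈⟨ ⊕-cong (≋-refl {scale a (Q ⊗ R)}) (∷-cong refl (⊗-assoc P Q R)) ⟩
    scale a (Q ⊗ R) ⊕ (0# ∷ (P ⊗ (Q ⊗ R)))       ∎
    where open ≋-Reasoning

  one : Poly
  one = const 1#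

  ⊗-identityˡ : ∀ P → one ⊗ P ≋ P
  ⊗-identityˡ P = ≋-trans (⊕-cong (scale-identity P) (0∷-≋[] ≋-refl)) (⊕-identityʳ P)

  ⊗-identityʳ : ∀ P → P ⊗ one ≋ P
  ⊗-identityʳ P = ≋-trans (⊗-comm P one) (⊗-identityˡ P)

  ⊗-distribˡ-⊕ : ∀ P Q Q′ → P ⊗ (Q ⊕ Q′) ≋ (P ⊗ Q) ⊕ (P ⊗ Q′)
  ⊗-distribˡ-⊕ P Q Q′ =
    ≋-trans (⊗-comm P _) (≋-trans (⊗-distribʳ-⊕ Q Q′ P) (⊕-cong (⊗-comm Q P) (⊗-comm Q′ P)))

  polyRing : CommutativeRing 0ℓ 0ℓ
  polyRing = record
    { Carrier = Poly ; _≈_ = _≋_ ; _+_ = _⊕_ ; _*_ = _⊗_ ; -_ = neg ; 0# = [] ; 1# = one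
    ; isCommutativeRing = record
      { isRing = record
        { +-isAbelianGroup = record
          { isGroup = record
            { isMonoid = record
              { isSemigroup = record
                { isMagma = record
                  { isEquivalence = Setoid.isEquivalence ≋-setoid ; ∙-cong = ⊕-cong }
                ; assoc = ⊕-assoc }
              ; identity = (λ P → ≋-refl) , ⊕-identityʳ }
            ; inverse = ⊕-inverseˡ , ⊕-inverseʳ
            ; ⁻¹-cong = neg-cong }
          ; comm = ⊕-comm }
        ; *-cong = ⊗-cong
        ; *-assoc = ⊗-assoc
        ; *-identity = ⊗-identityˡ , ⊗-identityʳ
        ; distrib = ⊗-distribˡ-⊕ , (λ P Q R → ⊗-distribʳ-⊕ Q R P) }
      ; *-comm = ⊗-comm } }

  module PolySolver = NaturalSolver (CommutativeRing.commutativeSemiring polyRing)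

  -- Degrees and leading coefficients

  norm-≋ : ∀ P → norm P ≋ P
  norm-≋ [] = ≋-refl
  norm-≋ (x ∷ xs) with norm xs | norm-≋ xs
  ... | y ∷ ys | e = ∷-cong refl e
  ... | []     | e with x ≟ 0#
  ...   | yes x≡0 = ≋-sym (≋-trans (∷-cong x≡0 (≋-sym e)) (0∷-≋[] ≋-refl))
  ...   | no  _   = ∷-cong refl e

  data Normal : Poly → Set where
    []  : Normal []
    [_] : ∀ {x} → x ≢ 0# → Normal (x ∷ [])
    _∷_ : ∀ x {y ys} → Normal (y ∷ ys) → Normal (x ∷ y ∷ ys)

  norm-Normal : ∀ P → Normal (norm P)
  norm-Normal [] = []
  norm-Normal (x ∷ xs) with norm xs | norm-Normal xs
  ... | y ∷ ys | n = x ∷ n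
  ... | []     | n with x ≟ 0#
  ...   | yes _   = []
  ...   | no  x≢0 = [ x≢0 ]

  Normal-tail : ∀ {x xs} → Normal (x ∷ xs) → Normal xs
  Normal-tail [ _ ]   = []
  Normal-tail (_ ∷ n) = n

  Normal-≋[] : ∀ {P} → Normal P → P ≋ [] → P ≡ []
  Normal-≋[] []      e = refl
  Normal-≋[] [ x≢0 ] e = ⊥-elim (x≢0 (at e 0))
  Normal-≋[] (x ∷ n) e with Normal-≋[] n (∷≋[]-tail e)
  ... | ()

  Normal-≋⇒≡ : ∀ {P Q} → Normal P → Normal Q → P ≋ Q → P ≡ Q
  Normal-≋⇒≡ {[]}    {Q}     nP nQ e = sym (Normal-≋[] nQ (≋-sym e))
  Normal-≋⇒≡ {x ∷ P} {[]}    nP nQ e = Normal-≋[] nP e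
  Normal-≋⇒≡ {x ∷ P} {y ∷ Q} nP nQ e =
    cong₂ _∷_ (at e 0) (Normal-≋⇒≡ (Normal-tail nP) (Normal-tail nQ) (≋-tail e))

  ≋⇒≈ₚ : ∀ {P Q} → P ≋ Q → P ≈ₚ Q
  ≋⇒≈ₚ {P} {Q} e = Normal-≋⇒≡ (norm-Normal P) (norm-Normal Q)
    (≋-trans (norm-≋ P) (≋-trans e (≋-sym (norm-≋ Q))))

  norm-≋[] : ∀ {P} → P ≋ [] → norm P ≡ []
  norm-≋[] P≋0 = ≋⇒≈ₚ P≋0

  record Bounded (P : Poly) (d : ℕ) : Set where
    constructor mkBounded
    field vanish : ∀ n → d ℕ.≤ n → coeff P n ≡ 0#

  open Bounded public

  record HasLead (P : Poly) (d : ℕ) (c : Carrier) : Set where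
    constructor mkLead
    field
      lead-coeff   : coeff P d ≡ c
      lead-nonzero : c ≢ 0#
      lead-bounded : Bounded P (suc d)

  open HasLead public

  bounded-≋ : ∀ {P Q d} → P ≋ Q → Bounded P d → Bounded Q d
  bounded-≋ e b = mkBounded λ n d≤n → trans (sym (at e n)) (vanish b n d≤n)

  lead-≋ : ∀ {P Q d c} → P ≋ Q → HasLead P d c → HasLead Q d c
  lead-≋ e (mkLead l c≢0 b) = mkLead (trans (sym (at e _)) l) c≢0 (bounded-≋ e b)

  bounded-mono : ∀ {P d e} → d ℕ.≤ e → Bounded P d → Bounded P e
  bounded-mono d≤e b = mkBounded λ n e≤n → vanish b n (ℕₚ.≤-trans d≤e e≤n)

  bounded-zero : ∀ {P d} → P ≋ [] → Bounded P d
  bounded-zero e = mkBounded λ n _ → at e n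

  bounded-0 : ∀ {P} → Bounded P 0 → P ≋ []
  bounded-0 b = mk≋ λ n → vanish b n z≤n

  bounded-⊕ : ∀ {P Q d} → Bounded P d → Bounded Q d → Bounded (P ⊕ Q) d
  bounded-⊕ {P} {Q} bP bQ = mkBounded λ n d≤n →
    trans (coeff-⊕ P Q n) (trans (cong₂ _+_ (vanish bP n d≤n) (vanish bQ n d≤n)) (+-identityˡ 0#))

  bounded-scale : ∀ {P d} c → Bounded P d → Bounded (scale c P) d
  bounded-scale {P} c b = mkBounded λ n d≤n →
    trans (coeff-scale c P n) (trans (cong (c *_) (vanish b n d≤n)) (zeroʳ c))

  bounded-neg : ∀ {P d} → Bounded P d → Bounded (neg P) d
  bounded-neg {P} b = mkBounded λ n d≤n →
    trans (coeff-neg P n) (trans (cong -_ (vanish b n d≤n)) -0#≈0#)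

  bounded-length : ∀ P → Bounded P (length P)
  bounded-length []      = mkBounded λ _ _ → refl
  bounded-length (x ∷ P) = mkBounded λ { (suc n) (s≤s ℓ≤n) → vanish (bounded-length P) n ℓ≤n }

  bounded-∷ : ∀ {x P d} → Bounded P d → Bounded (x ∷ P) (suc d)
  bounded-∷ b = mkBounded λ { (suc n) (s≤s d≤n) → vanish b n d≤n }

  bounded-tail : ∀ {x P d} → Bounded (x ∷ P) (suc d) → Bounded P d
  bounded-tail b = mkBounded λ n d≤n → vanish b (suc n) (s≤s d≤n)

  bounded-⊗ : ∀ P Q d e → Bounded P (suc d) → Bounded Q (suc e) → Bounded (P ⊗ Q) (suc (d ℕ.+ e))
  bounded-⊗ []      Q d       e bP bQ = bounded-zero ≋-refl
  bounded-⊗ (a ∷ P) Q zero    e bP bQ =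
    bounded-⊕ (bounded-scale a bQ)
              (bounded-zero (0∷-≋[] (⊗-zeroˡ Q (bounded-0 (bounded-tail bP)))))
  bounded-⊗ (a ∷ P) Q (suc d) e bP bQ =
    bounded-⊕ (bounded-mono (s≤s (ℕₚ.m≤n+m e (suc d))) (bounded-scale a bQ))
              (bounded-∷ (bounded-⊗ P Q d e (bounded-tail bP) bQ))

  coeff-⊗-top : ∀ P Q d e → Bounded P (suc d) → Bounded Q (suc e) →
                coeff (P ⊗ Q) (d ℕ.+ e) ≡ coeff P d * coeff Q e
  coeff-⊗-top []      Q d       e bP bQ = sym (zeroˡ _)
  coeff-⊗-top (a ∷ P) Q zero    e bP bQ = begin
    coeff (scale a Q ⊕ (0# ∷ (P ⊗ Q))) e            ≡⟨ coeff-⊕ (scale a Q) _ e ⟩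
    coeff (scale a Q) e + coeff (0# ∷ (P ⊗ Q)) e    ≡⟨ cong₂ _+_ (coeff-scale a Q e) (at P⊗Q≋0 e) ⟩
    a * coeff Q e + 0#                              ≡⟨ +-identityʳ _ ⟩
    a * coeff Q e                                   ∎
    where
    open ≡-Reasoning
    P⊗Q≋0 = 0∷-≋[] (⊗-zeroˡ Q (bounded-0 (bounded-tail bP)))
  coeff-⊗-top (a ∷ P) Q (suc d) e bP bQ = begin
    coeff (scale a Q ⊕ (0# ∷ (P ⊗ Q))) (suc (d ℕ.+ e))            ≡⟨ coeff-⊕ (scale a Q) _ (suc (d ℕ.+ e)) ⟩
    coeff (scale a Q) (suc (d ℕ.+ e)) + coeff (P ⊗ Q) (d ℕ.+ e)   ≡⟨ cong₂ _+_ high (coeff-⊗-top P Q d e (bounded-tail bP) bQ) ⟩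
    0# + coeff P d * coeff Q e                                     ≡⟨ +-identityˡ _ ⟩
    coeff P d * coeff Q e                                          ∎
    where
    open ≡-Reasoning
    high = vanish (bounded-scale a bQ) (suc (d ℕ.+ e)) (s≤s (ℕₚ.m≤n+m e d))

  lead-⊗ : ∀ {P Q d e a b} → HasLead P d a → HasLead Q e b → HasLead (P ⊗ Q) (d ℕ.+ e) (a * b)
  lead-⊗ {P} {Q} {d} {e} (mkLead la a≢0 bP) (mkLead lb b≢0 bQ) = mkLead
    (trans (coeff-⊗-top P Q d e bP bQ) (cong₂ _*_ la lb)) (*-nonzero a≢0 b≢0) (bounded-⊗ P Q d e bP bQ)

  lead-scale : ∀ {P d a} c → c ≢ 0# → HasLead P d a → HasLead (scale c P) d (c * a)
  lead-scale {P} {d} c c≢0 (mkLead la a≢0 bP) =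
    mkLead (trans (coeff-scale c P d) (cong (c *_) la)) (*-nonzero c≢0 a≢0) (bounded-scale c bP)

  lead-neg : ∀ {P d c} → HasLead P d c → HasLead (neg P) d (- c)
  lead-neg {P} {d} (mkLead l c≢0 b) =
    mkLead (trans (coeff-neg P d) (cong -_ l)) (λ -c≡0 → c≢0 (-‿injective (trans -c≡0 (sym -0#≈0#)))) (bounded-neg b)

  lead-⊕ʳ : ∀ {P Q d a} → Bounded P d → HasLead Q d a → HasLead (P ⊕ Q) d a
  lead-⊕ʳ {P} {Q} {d} bP (mkLead la a≢0 bQ) = mkLead
    (trans (coeff-⊕ P Q d) (trans (cong₂ _+_ (vanish bP d ℕₚ.≤-refl) la) (+-identityˡ _)))
    a≢0 (bounded-⊕ (bounded-mono (ℕₚ.n≤1+n d) bP) bQ)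

  lead-combination : ∀ {A B C d a c} x y z → HasLead A d a → Bounded B d → HasLead C d c → x * a + z * c ≢ 0# →
                     HasLead (scale x A ⊕ scale y B ⊕ scale z C) d (x * a + z * c)
  lead-combination {A} {B} {C} {d} {a} {c} x y z lA bB lC ≢0 = mkLead coeff-d ≢0
    (bounded-⊕ (bounded-⊕ (bounded-scale x (lead-bounded lA)) (bounded-scale y (bounded-mono (ℕₚ.n≤1+n d) bB)))
               (bounded-scale z (lead-bounded lC)))
    where
    open ≡-Reasoning
    coeff-d : coeff (scale x A ⊕ scale y B ⊕ scale z C) d ≡ x * a + z * c
    coeff-d = begin
      coeff (scale x A ⊕ scale y B ⊕ scale z C) d
        ≡⟨ trans (coeff-⊕ (scale x A ⊕ scale y B) (scale z C) d) (cong (_+ _) (coeff-⊕ (scale x A) (scale y B) d)) ⟩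
      (coeff (scale x A) d + coeff (scale y B) d) + coeff (scale z C) d
        ≡⟨ cong₂ _+_ (cong₂ _+_ (coeff-scale x A d) (coeff-scale y B d)) (coeff-scale z C d) ⟩
      (x * coeff A d + y * coeff B d) + z * coeff C d
        ≡⟨ cong₂ (λ u v → (x * u + y * v) + z * coeff C d) (lead-coeff lA) (vanish bB d ℕₚ.≤-refl) ⟩
      (x * a + y * 0#) + z * coeff C d
        ≡⟨ cong₂ (λ u v → u + z * v) (trans (cong (x * a +_) (zeroʳ y)) (+-identityʳ _)) (lead-coeff lC) ⟩
      x * a + z * c ∎

  ¬lead-bounded : ∀ {P d a} → HasLead P d a → ¬ Bounded P d
  ¬lead-bounded (mkLead la a≢0 _) b = a≢0 (trans (sym la) (vanish b _ ℕₚ.≤-refl))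

  zero-or-lead : ∀ P → P ≋ [] ⊎ ∃[ d ] ∃[ c ] HasLead P d c
  zero-or-lead [] = inj₁ ≋-refl
  zero-or-lead (x ∷ P) with zero-or-lead P
  ... | inj₂ (d , c , mkLead l c≢0 b) = inj₂ (suc d , c , mkLead l c≢0 (bounded-∷ b))
  ... | inj₁ P≋0 with x ≟ 0#
  ...   | yes x≡0 = inj₁ (≋-trans (∷-cong x≡0 P≋0) (0∷-≋[] ≋-refl))
  ...   | no  x≢0 = inj₂ (0 , x , mkLead refl x≢0 (bounded-∷ (bounded-zero P≋0)))

  Normal-lead : ∀ {P d c} → Normal P → HasLead P d c → length P ≡ suc d × lastOr 0# P ≡ c
  Normal-lead []                  l = ⊥-elim (lead-nonzero l (sym (lead-coeff l)))
  Normal-lead {d = zero}  [ _ ]   l = refl , lead-coeff l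
  Normal-lead {d = suc d} [ _ ]   l = ⊥-elim (lead-nonzero l (sym (lead-coeff l)))
  Normal-lead {d = zero}  (x ∷ n) l with Normal-≋[] n (bounded-0 (bounded-tail (lead-bounded l)))
  ... | ()
  Normal-lead {d = suc d} (x ∷ n) (mkLead l c≢0 b) with Normal-lead n (mkLead l c≢0 (bounded-tail b))
  ... | len , last = cong suc len , last

  norm-lead : ∀ {P d c} → HasLead P d c → length (norm P) ≡ suc d × lastOr 0# (norm P) ≡ c
  norm-lead {P} l = Normal-lead (norm-Normal P) (lead-≋ (≋-sym (norm-≋ P)) l)

  deg-lead : ∀ {P d c} → HasLead P d c → deg P ≡ d
  deg-lead l = cong (_∸ 1) (proj₁ (norm-lead l))

  sgn-lead : ∀ {P d c} → HasLead P d c → sgn P ≡ c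
  sgn-lead l = proj₂ (norm-lead l)

  ∣∣-lead : ∀ {P d c} → HasLead P d c → ∣ P ∣ ≡ q ^ d
  ∣∣-lead {P} l with norm P in eq
  ... | []    = ⊥-elim (ℕₚ.0≢1+n (trans (cong length (sym eq)) (proj₁ (norm-lead l))))
  ... | _ ∷ _ = cong (q ^_) (deg-lead l)

  ∣∣-zero : ∀ {P} → P ≋ [] → ∣ P ∣ ≡ 0
  ∣∣-zero {P} P≋0 with norm P in eq
  ... | []    = refl
  ... | _ ∷ _ with trans (sym eq) (norm-≋[] P≋0)
  ... | ()

  monomial : ℕ → Carrier → Poly
  monomial zero    c = c ∷ []
  monomial (suc j) c = 0# ∷ monomial j c

  bounded-monomial : ∀ j c → Bounded (monomial j c) (suc j)
  bounded-monomial zero    c = bounded-∷ (bounded-zero ≋-refl)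
  bounded-monomial (suc j) c = bounded-∷ (bounded-monomial j c)

  coeff-monomial : ∀ j c → coeff (monomial j c) j ≡ c
  coeff-monomial zero    c = refl
  coeff-monomial (suc j) c = coeff-monomial j c

  +-*-inverse-cancel : ∀ a b (a≢0 : a ≢ 0#) → b + a * - (b * inv a a≢0) ≡ 0#
  +-*-inverse-cancel a b a≢0 = begin
    b + a * - (b * a⁻¹)    ≡⟨ cong (b +_) (-‿distribʳ-* a (b * a⁻¹)) ⟨
    b + - (a * (b * a⁻¹))  ≡⟨ cong (λ x → b + - x) (solve 3 (λ a b a⁻¹ → (a :* (b :* a⁻¹)) := (b :* (a :* a⁻¹))) refl a b a⁻¹) ⟩
    b + - (b * (a * a⁻¹))  ≡⟨ cong (λ x → b + - (b * x)) (*-inverseʳ a a≢0) ⟩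
    b + - (b * 1#)         ≡⟨ cong (λ x → b + - x) (*-identityʳ b) ⟩
    b + - b                ≡⟨ -‿inverseʳ b ⟩
    0#                     ∎
    where
    open ≡-Reasoning
    open FieldSolver
    a⁻¹ = inv a a≢0

  -- subtract the monomial multiple of A that kills the coefficient of t^m in B
  eliminate-top : ∀ {A d a} → HasLead A d a → ∀ {B m} → Bounded B (suc m) → d ℕ.≤ m →
                  ∃[ M ] Bounded (B ⊕ A ⊗ M) m
  eliminate-top {A} {d} {a} lA {B} {m} bB d≤m = M , mkBounded vanish-from-m
    where
    j = m ∸ d
    c = - (coeff B m * inv a (lead-nonzero lA))
    M = monomial j c
    d+j≡m : d ℕ.+ j ≡ m
    d+j≡m = ℕₚ.m+[n∸m]≡n d≤m
    coeff-AM : coeff (A ⊗ M) m ≡ a * c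
    coeff-AM = subst (λ n → coeff (A ⊗ M) n ≡ a * c) d+j≡m
      (trans (coeff-⊗-top A M d j (lead-bounded lA) (bounded-monomial j c))
             (cong₂ _*_ (lead-coeff lA) (coeff-monomial j c)))
    bounded-AM : Bounded (A ⊗ M) (suc m)
    bounded-AM = subst (λ n → Bounded (A ⊗ M) (suc n)) d+j≡m
      (bounded-⊗ A M d j (lead-bounded lA) (bounded-monomial j c))
    vanish-from-m : ∀ n → m ℕ.≤ n → coeff (B ⊕ A ⊗ M) n ≡ 0#
    vanish-from-m n m≤n with ℕₚ.m≤n⇒m<n∨m≡n m≤n
    ... | inj₁ m<n  = vanish (bounded-⊕ bB bounded-AM) n m<n
    ... | inj₂ refl = trans (coeff-⊕ B (A ⊗ M) m)
      (trans (cong (coeff B m +_) coeff-AM) (+-*-inverse-cancel a (coeff B m) (lead-nonzero lA)))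

  remainder : ∀ {A d a} → HasLead A d a → ∀ m {B} → Bounded B m → ∃[ k ] Bounded (B ⊕ A ⊗ k) d
  remainder {A} {d} lA zero {B} bB =
    [] , bounded-⊕ (bounded-zero (bounded-0 bB)) (bounded-zero (⊗-zeroʳ A))
  remainder {A} {d} lA (suc m) {B} bB with d ℕ.≤? m
  ... | no  d≰m = [] , bounded-⊕ (bounded-mono (ℕₚ.≰⇒> d≰m) bB) (bounded-zero (⊗-zeroʳ A))
  ... | yes d≤m with eliminate-top lA bB d≤m
  ... | M , bB′ with remainder lA m bB′
  ... | k , bB″ = M ⊕ k , bounded-≋ reassociate bB″
    where
    open ≋-Reasoning
    reassociate : (B ⊕ A ⊗ M) ⊕ A ⊗ k ≋ B ⊕ A ⊗ (M ⊕ k)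
    reassociate = begin
      (B ⊕ A ⊗ M) ⊕ A ⊗ k    ≈⟨ ⊕-assoc B (A ⊗ M) (A ⊗ k) ⟩
      B ⊕ (A ⊗ M ⊕ A ⊗ k)    ≈⟨ ⊕-cong (≋-refl {B}) (⊗-distribˡ-⊕ A M k) ⟨
      B ⊕ A ⊗ (M ⊕ k)        ∎

  division : ∀ {A d a} → HasLead A d a → ∀ B → ∃[ k ] Bounded (B ⊕ A ⊗ k) d
  division lA B = remainder lA (length B) (bounded-length B)

  -- Forms under unimodular substitutions

  infix 4 _≋F_
  record _≋F_ (f g : Form) : Set where
    constructor mk≋F
    field
      A-≋ : A f ≋ A g
      B-≋ : B f ≋ B g
      C-≋ : C f ≋ C g

  open _≋F_ public

  ≋F-sym : ∀ {f g} → f ≋F g → g ≋F f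
  ≋F-sym (mk≋F a b c) = mk≋F (≋-sym a) (≋-sym b) (≋-sym c)

  ≋F-trans : ∀ {f g h} → f ≋F g → g ≋F h → f ≋F h
  ≋F-trans (mk≋F a b c) (mk≋F a′ b′ c′) = mk≋F (≋-trans a a′) (≋-trans b b′) (≋-trans c c′)

  scale-two : ∀ X → scale two X ≋ X ⊕ X
  scale-two X = begin
    scale (1# + 1#) X          ≈⟨ scale-distribˡ 1# 1# X ⟩
    scale 1# X ⊕ scale 1# X    ≈⟨ ⊕-cong (scale-identity X) (scale-identity X) ⟩
    X ⊕ X                      ∎
    where open ≋-Reasoning

  scale-four : ∀ X → scale four X ≋ (X ⊕ X) ⊕ (X ⊕ X)
  scale-four X = begin
    scale (two + two) X          ≈⟨ scale-distribˡ two two X ⟩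
    scale two X ⊕ scale two X    ≈⟨ ⊕-cong (scale-two X) (scale-two X) ⟩
    (X ⊕ X) ⊕ (X ⊕ X)            ∎
    where open ≋-Reasoning

  infixl 5 _∘ᵣ_
  _∘ᵣ_ : Form → Mat → Form
  form A B C ∘ᵣ mat α β γ δ = form (A′ A B C α β γ δ) (B′ A B C α β γ δ) (C′ A B C α β γ δ)
    where open Substitution _⊕_ _⊗_

  ∘ₘ-≋-∘ᵣ : ∀ f M → f ∘ₘ M ≋F f ∘ᵣ M
  ∘ₘ-≋-∘ᵣ (form A B C) (mat α β γ δ) = mk≋F ≋-refl
    (⊕-cong (⊕-cong (scale-two (A ⊗ α ⊗ β)) ≋-refl) (scale-two (C ⊗ γ ⊗ δ))) ≋-refl

  infixl 7 _·ₘ_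
  _·ₘ_ : Mat → Mat → Mat
  mat α β γ δ ·ₘ mat α′ β′ γ′ δ′ =
    mat ((α ⊗ α′) ⊕ (β ⊗ γ′)) ((α ⊗ β′) ⊕ (β ⊗ δ′)) ((γ ⊗ α′) ⊕ (δ ⊗ γ′)) ((γ ⊗ β′) ⊕ (δ ⊗ δ′))

  ∘ᵣ-·ₘ : ∀ f M N → (f ∘ᵣ M) ∘ᵣ N ≋F f ∘ᵣ (M ·ₘ N)
  ∘ᵣ-·ₘ (form A B C) (mat α β γ δ) (mat α′ β′ γ′ δ′) = mk≋F
    (solve 11 (λ A B C α β γ δ α′ β′ γ′ δ′ → twice A′ A B C α β γ δ α′ β′ γ′ δ′ := once A′ A B C α β γ δ α′ β′ γ′ δ′)
       ≋-refl A B C α β γ δ α′ β′ γ′ δ′)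
    (solve 11 (λ A B C α β γ δ α′ β′ γ′ δ′ → twice B′ A B C α β γ δ α′ β′ γ′ δ′ := once B′ A B C α β γ δ α′ β′ γ′ δ′)
       ≋-refl A B C α β γ δ α′ β′ γ′ δ′)
    (solve 11 (λ A B C α β γ δ α′ β′ γ′ δ′ → twice C′ A B C α β γ δ α′ β′ γ′ δ′ := once C′ A B C α β γ δ α′ β′ γ′ δ′)
       ≋-refl A B C α β γ δ α′ β′ γ′ δ′)
    where
    open PolySolver using (solve; _:=_; _:+_; _:*_)
    open Substitution _:+_ _:*_

  ∘ᵣ-congˡ : ∀ {f g} M → f ≋F g → f ∘ᵣ M ≋F g ∘ᵣ M
  ∘ᵣ-congˡ (mat α β γ δ) (mk≋F a b c) = mk≋F
    (⊕-cong (⊕-cong (⊗⊗-congˡ a) (⊗⊗-congˡ b)) (⊗⊗-congˡ c))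
    (⊕-cong (⊕-cong (⊕-cong (⊗⊗-congˡ a) (⊗⊗-congˡ a)) (⊗-congˡ _ b)) (⊕-cong (⊗⊗-congˡ c) (⊗⊗-congˡ c)))
    (⊕-cong (⊕-cong (⊗⊗-congˡ a) (⊗⊗-congˡ b)) (⊗⊗-congˡ c))
    where
    ⊗⊗-congˡ : ∀ {P Q X Y} → P ≋ Q → P ⊗ X ⊗ Y ≋ Q ⊗ X ⊗ Y
    ⊗⊗-congˡ e = ⊗-congˡ _ (⊗-congˡ _ e)

  ∘ₘ-congˡ : ∀ {f g} M → f ≋F g → f ∘ₘ M ≋F g ∘ₘ M
  ∘ₘ-congˡ {f} {g} M e =
    ≋F-trans (∘ₘ-≋-∘ᵣ f M) (≋F-trans (∘ᵣ-congˡ M e) (≋F-sym (∘ₘ-≋-∘ᵣ g M)))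

  ∘ₘ-·ₘ : ∀ f M N → (f ∘ₘ M) ∘ₘ N ≋F f ∘ₘ (M ·ₘ N)
  ∘ₘ-·ₘ f M N = ≋F-trans (∘ₘ-≋-∘ᵣ (f ∘ₘ M) N) (≋F-trans (∘ᵣ-congˡ N (∘ₘ-≋-∘ᵣ f M))
                  (≋F-trans (∘ᵣ-·ₘ f M N) (≋F-sym (∘ₘ-≋-∘ᵣ f (M ·ₘ N)))))

  open Differences polyRing using (-‿cross; *-distrib--)

  det-·ₘ : ∀ M N → det (M ·ₘ N) ≋ det M ⊗ det N
  det-·ₘ (mat α β γ δ) (mat α′ β′ γ′ δ′) = begin
    X ⊖ Y                                         ≈⟨ -‿cross X Y ((a ⊗ c) ⊕ (b ⊗ d)) ((a ⊗ d) ⊕ (b ⊗ c)) cross ⟩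
    ((a ⊗ c) ⊕ (b ⊗ d)) ⊖ ((a ⊗ d) ⊕ (b ⊗ c))     ≈⟨ *-distrib-- a b c d ⟨
    (a ⊖ b) ⊗ (c ⊖ d)                             ∎
    where
    open ≋-Reasoning
    open PolySolver using (solve; _:=_; _:+_; _:*_)
    a = α ⊗ δ
    b = β ⊗ γ
    c = α′ ⊗ δ′
    d = β′ ⊗ γ′
    X = ((α ⊗ α′) ⊕ (β ⊗ γ′)) ⊗ ((γ ⊗ β′) ⊕ (δ ⊗ δ′))
    Y = ((α ⊗ β′) ⊕ (β ⊗ δ′)) ⊗ ((γ ⊗ α′) ⊕ (δ ⊗ γ′))
    cross : X ⊕ ((a ⊗ d) ⊕ (b ⊗ c)) ≋ ((a ⊗ c) ⊕ (b ⊗ d)) ⊕ Y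
    cross = solve 8 (λ α β γ δ α′ β′ γ′ δ′ →
      ((((α :* α′) :+ (β :* γ′)) :* ((γ :* β′) :+ (δ :* δ′))) :+ (((α :* δ) :* (β′ :* γ′)) :+ ((β :* γ) :* (α′ :* δ′))))
      := ((((α :* δ) :* (α′ :* δ′)) :+ ((β :* γ) :* (β′ :* γ′))) :+ (((α :* β′) :+ (β :* δ′)) :* ((γ :* α′) :+ (δ :* γ′)))))
      ≋-refl α β γ δ α′ β′ γ′ δ′

  disc-cong : ∀ {f g} → f ≋F g → disc f ≋ disc g
  disc-cong (mk≋F a b c) = ⊕-cong (⊗-cong b b) (neg-cong (scale-cong refl (⊗-cong a c)))

  disc-∘ₘ : ∀ f M → disc (f ∘ₘ M) ≋ (det M ⊗ det M) ⊗ disc f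
  disc-∘ₘ (form A B C) (mat α β γ δ) = begin
    disc (form A B C ∘ₘ mat α β γ δ)                ≈⟨ disc-cong (∘ₘ-≋-∘ᵣ (form A B C) (mat α β γ δ)) ⟩
    (B₁ ⊗ B₁) ⊖ scale four (A₁ ⊗ C₁)                ≈⟨ ⊕-cong (≋-refl {B₁ ⊗ B₁}) (neg-cong (scale-four (A₁ ⊗ C₁))) ⟩
    (B₁ ⊗ B₁) ⊖ 4A₁C₁                               ≈⟨ -‿cross (B₁ ⊗ B₁) 4A₁C₁ ((U ⊗ B²) ⊕ (V ⊗ 4AC)) ((U ⊗ 4AC) ⊕ (V ⊗ B²)) cross ⟩
    ((U ⊗ B²) ⊕ (V ⊗ 4AC)) ⊖ ((U ⊗ 4AC) ⊕ (V ⊗ B²))  ≈⟨ *-distrib-- U V B² 4AC ⟨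
    (U ⊖ V) ⊗ (B² ⊖ 4AC)                            ≈⟨ ⊗-cong (*-distrib-- a b a b) (⊕-cong (≋-refl {B²}) (neg-cong (scale-four (A ⊗ C)))) ⟨
    ((a ⊖ b) ⊗ (a ⊖ b)) ⊗ (B² ⊖ scale four (A ⊗ C)) ∎
    where
    open ≋-Reasoning
    open PolySolver using (solve; _:=_; _:+_; _:*_)
    open Substitution _⊕_ _⊗_ using () renaming (A′ to A″; B′ to B″; C′ to C″)
    A₁ = A″ A B C α β γ δ
    B₁ = B″ A B C α β γ δ
    C₁ = C″ A B C α β γ δ
    a = α ⊗ δ
    b = β ⊗ γ
    U = (a ⊗ a) ⊕ (b ⊗ b)
    V = (a ⊗ b) ⊕ (b ⊗ a)
    B² = B ⊗ B
    4AC = ((A ⊗ C) ⊕ (A ⊗ C)) ⊕ ((A ⊗ C) ⊕ (A ⊗ C))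
    4A₁C₁ = ((A₁ ⊗ C₁) ⊕ (A₁ ⊗ C₁)) ⊕ ((A₁ ⊗ C₁) ⊕ (A₁ ⊗ C₁))
    cross : (B₁ ⊗ B₁) ⊕ ((U ⊗ 4AC) ⊕ (V ⊗ B²)) ≋ ((U ⊗ B²) ⊕ (V ⊗ 4AC)) ⊕ 4A₁C₁
    cross = solve 7 (λ A B C α β γ δ →
      let open Substitution _:+_ _:*_
          A₁ = A′ A B C α β γ δ ; B₁ = B′ A B C α β γ δ ; C₁ = C′ A B C α β γ δ
          a = α :* δ ; b = β :* γ
          U = (a :* a) :+ (b :* b) ; V = (a :* b) :+ (b :* a)
          4AC = ((A :* C) :+ (A :* C)) :+ ((A :* C) :+ (A :* C))
          4A₁C₁ = ((A₁ :* C₁) :+ (A₁ :* C₁)) :+ ((A₁ :* C₁) :+ (A₁ :* C₁))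
      in ((B₁ :* B₁) :+ ((U :* 4AC) :+ (V :* (B :* B)))) := (((U :* (B :* B)) :+ (V :* 4AC)) :+ 4A₁C₁))
      ≋-refl A B C α β γ δ

  disc-≋-B² : ∀ {A B C} → A ⊗ C ≋ [] → disc (form A B C) ≋ B ⊗ B
  disc-≋-B² {B = B} AC≋0 =
    ≋-trans (⊕-cong (≋-refl {B ⊗ B}) (neg-cong (scale-cong {four} refl AC≋0))) (⊕-identityʳ (B ⊗ B))

  lead-disc : ∀ {A B C d e a c} → four ≢ 0# → HasLead A d a → Bounded B d → HasLead C e c → d ℕ.≤ e →
              HasLead (disc (form A B C)) (d ℕ.+ e) (- (four * (a * c)))
  lead-disc four≢0 lA bB lC d≤e =
    lead-⊕ʳ (bounded-square bB d≤e) (lead-neg (lead-scale four four≢0 (lead-⊗ lA lC)))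
    where
    bounded-square : ∀ {B d e} → Bounded B d → d ℕ.≤ e → Bounded (B ⊗ B) (d ℕ.+ e)
    bounded-square {B} {zero}  bB _   = bounded-zero (⊗-zeroˡ B (bounded-0 bB))
    bounded-square {B} {suc d} bB d≤e =
      bounded-mono (s≤s (ℕₚ.+-monoʳ-≤ d (ℕₚ.≤-trans (ℕₚ.n≤1+n d) d≤e))) (bounded-⊗ B B d d bB bB)

  bounded-disc : ∀ {A B C d e a c} → HasLead A d a → Bounded B d → HasLead C e c → e ℕ.< d →
                 Bounded (disc (form A B C)) (d ℕ.+ d)
  bounded-disc {A} {B} {C} {suc d} {e} lA bB lC e<d =
    bounded-⊕ (bounded-mono (s≤s (ℕₚ.+-monoʳ-≤ d (ℕₚ.n≤1+n d))) (bounded-⊗ B B d d bB bB))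
              (bounded-neg (bounded-scale four (bounded-mono AC<2d (lead-bounded (lead-⊗ lA lC)))))
    where
    AC<2d : suc (suc d ℕ.+ e) ℕ.≤ suc d ℕ.+ suc d
    AC<2d = subst (ℕ._≤ suc d ℕ.+ suc d) (ℕₚ.+-suc (suc d) e) (ℕₚ.+-monoʳ-≤ (suc d) e<d)

  const-⊗-const : ∀ a b → const a ⊗ const b ≋ const (a * b)
  const-⊗-const a b = ∷-cong (+-identityʳ _) ≋-refl

  ⊗-const : ∀ P c → P ⊗ const c ≋ scale c P
  ⊗-const P c = ≋-trans (⊗-comm P (const c)) (≋-trans (⊕-cong (≋-refl {scale c P}) (0∷-≋[] ≋-refl)) (⊕-identityʳ _))

  ⊗-const-const : ∀ P a b → P ⊗ const a ⊗ const b ≋ scale (a * b) P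
  ⊗-const-const P a b =
    ≋-trans (⊗-assoc P (const a) (const b)) (≋-trans (⊗-congʳ P (const-⊗-const a b)) (⊗-const P (a * b)))

  diagonal : Carrier → Carrier → Mat
  diagonal α δ = mat (const α) [] [] (const δ)

  ∘ₘ-diagonal : ∀ f α δ → f ∘ₘ diagonal α δ ≋F form (scale (α * α) (A f)) (scale (α * δ) (B f)) (scale (δ * δ) (C f))
  ∘ₘ-diagonal f@(form A B C) α δ = ≋F-trans (∘ₘ-≋-∘ᵣ f (diagonal α δ)) (mk≋F
    (≋-trans (solve 5 (λ A B C α δ → let open Substitution _:+_ _:*_ in A′ A B C α (con 0) (con 0) δ := A :* α :* α)
                ≋-refl A B C (const α) (const δ)) (⊗-const-const A α α))
    (≋-trans (solve 5 (λ A B C α δ → let open Substitution _:+_ _:*_ in B′ A B C α (con 0) (con 0) δ := B :* α :* δ)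
                ≋-refl A B C (const α) (const δ)) (⊗-const-const B α δ))
    (≋-trans (solve 5 (λ A B C α δ → let open Substitution _:+_ _:*_ in C′ A B C α (con 0) (con 0) δ := C :* δ :* δ)
                ≋-refl A B C (const α) (const δ)) (⊗-const-const C δ δ)))
    where open PolySolver using (solve; _:=_; _:+_; _:*_; con)

  det-diagonal : ∀ α δ → det (diagonal α δ) ≋ const (α * δ)
  det-diagonal α δ = ≋-trans (⊕-cong (const-⊗-const α δ) (≋-refl {neg []})) (⊕-identityʳ _)

  swap : Mat
  swap = mat [] one one []

  ∘ₘ-swap : ∀ f → f ∘ₘ swap ≋F form (C f) (B f) (A f)
  ∘ₘ-swap f@(form A B C) = ≋F-trans (∘ₘ-≋-∘ᵣ f swap) (mk≋F
    (solve 3 (λ A B C → let open Substitution _:+_ _:*_ in A′ A B C (con 0) (con 1) (con 1) (con 0) := C) ≋-refl A B C)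
    (solve 3 (λ A B C → let open Substitution _:+_ _:*_ in B′ A B C (con 0) (con 1) (con 1) (con 0) := B) ≋-refl A B C)
    (solve 3 (λ A B C → let open Substitution _:+_ _:*_ in C′ A B C (con 0) (con 1) (con 1) (con 0) := A) ≋-refl A B C))
    where open PolySolver using (solve; _:=_; _:+_; _:*_; con)

  det-swap : det swap ≋ const (- 1#)
  det-swap = ∷-cong (cong -_ (trans (+-identityʳ _) (*-identityˡ 1#))) (≋-refl {[]})

  translation : Poly → Mat
  translation k = mat one k [] one

  ∘ₘ-translation : ∀ f k → f ∘ₘ translation k ≋F
                   form (A f) (B f ⊕ scale two (A f) ⊗ k) (C f ⊕ B f ⊗ k ⊕ A f ⊗ k ⊗ k)
  ∘ₘ-translation f@(form A B C) k = ≋F-trans (∘ₘ-≋-∘ᵣ f (translation k)) (mk≋F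
    (solve 4 (λ A B C k → let open Substitution _:+_ _:*_ in A′ A B C (con 1) k (con 0) (con 1) := A) ≋-refl A B C k)
    (≋-trans (solve 4 (λ A B C k → let open Substitution _:+_ _:*_ in
                B′ A B C (con 1) k (con 0) (con 1) := B :+ ((A :+ A) :* k)) ≋-refl A B C k)
             (⊕-cong (≋-refl {B}) (⊗-congˡ k (≋-sym (scale-two A)))))
    (solve 4 (λ A B C k → let open Substitution _:+_ _:*_ in
       C′ A B C (con 1) k (con 0) (con 1) := C :+ B :* k :+ A :* k :* k) ≋-refl A B C k))
    where open PolySolver using (solve; _:=_; _:+_; _:*_; con)

  det-translation : ∀ k → det (translation k) ≋ one
  det-translation k = ≋-trans (⊕-cong (⊗-identityˡ one) (neg-cong (⊗-zeroʳ k))) (⊕-identityʳ one)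

  constant : Carrier → Carrier → Carrier → Carrier → Mat
  constant α β γ δ = mat (const α) (const β) (const γ) (const δ)

  A-∘ₘ-constant : ∀ f α β γ δ →
    A (f ∘ₘ constant α β γ δ) ≋ scale (α * α) (A f) ⊕ scale (α * γ) (B f) ⊕ scale (γ * γ) (C f)
  A-∘ₘ-constant (form A B C) α β γ δ =
    ⊕-cong (⊕-cong (⊗-const-const A α α) (⊗-const-const B α γ)) (⊗-const-const C γ γ)

  det-constant : ∀ α β γ δ → det (constant α β γ δ) ≋ const (α * δ + - (β * γ))
  det-constant α β γ δ = ⊕-cong (const-⊗-const α δ) (neg-cong (const-⊗-const β γ))

  -- g = f ∘ₘ M with det M = ±1, which keeps the discriminant (disc-∘ₘ)
  infix 4 _⇝_
  record _⇝_ (f g : Form) : Set where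
    constructor transform
    field
      matrix     : Mat
      unit       : Carrier
      unit²      : unit * unit ≡ 1#
      det-matrix : det matrix ≋ const unit
      result     : f ∘ₘ matrix ≋F g

  ⇝-disc : ∀ {f g} → f ⇝ g → disc g ≋ disc f
  ⇝-disc {f} {g} (transform M u u² detM fM≋g) = begin
    disc g                                 ≈⟨ disc-cong (≋F-sym fM≋g) ⟩
    disc (f ∘ₘ M)                          ≈⟨ disc-∘ₘ f M ⟩
    (det M ⊗ det M) ⊗ disc f               ≈⟨ ⊗-congˡ (disc f) (≋-trans (⊗-cong detM detM) (const-⊗-const u u)) ⟩
    const (u * u) ⊗ disc f                 ≈⟨ ⊗-congˡ (disc f) (∷-cong u² (≋-refl {[]})) ⟩
    one ⊗ disc f                           ≈⟨ ⊗-identityˡ (disc f) ⟩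
    disc f                                 ∎
    where open ≋-Reasoning

  ⇝-trans : ∀ {f g h} → f ⇝ g → g ⇝ h → f ⇝ h
  ⇝-trans {f} (transform M u u² detM fM≋g) (transform N v v² detN gN≋h) = transform (M ·ₘ N) (u * v)
    (trans (sym ([xx][yy]≡[xy][xy] u v)) (trans (cong₂ _*_ u² v²) (*-identityˡ 1#)))
    (≋-trans (det-·ₘ M N) (≋-trans (⊗-cong detM detN) (const-⊗-const u v)))
    (≋F-trans (≋F-sym (∘ₘ-·ₘ f M N)) (≋F-trans (∘ₘ-congˡ N fM≋g) gN≋h))

  ⇝-≋F : ∀ {f g h} → f ⇝ g → g ≋F h → f ⇝ h
  ⇝-≋F (transform M u u² detM fM≋g) g≋h = transform M u u² detM (≋F-trans fM≋g g≋h)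

  ⇝-∃-trans : ∀ {P : Form → Set} {f g} → f ⇝ g → ∃[ h ] (g ⇝ h × P h) → ∃[ h ] (f ⇝ h × P h)
  ⇝-∃-trans f⇝g (h , g⇝h , Ph) = h , ⇝-trans f⇝g g⇝h , Ph

  ⇝-diagonal : ∀ f α δ → (α * δ) * (α * δ) ≡ 1# →
               f ⇝ form (scale (α * α) (A f)) (scale (α * δ) (B f)) (scale (δ * δ) (C f))
  ⇝-diagonal f α δ unit² = transform (diagonal α δ) (α * δ) unit² (det-diagonal α δ) (∘ₘ-diagonal f α δ)

  ⇝-refl : ∀ f → f ⇝ f
  ⇝-refl f@(form A B C) =
    ⇝-≋F (⇝-diagonal f 1# 1# 1²·1²≡1) (mk≋F (scale-1·1 A) (scale-1·1 B) (scale-1·1 C))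
    where
    1·1≡1 : 1# * 1# ≡ 1#
    1·1≡1 = *-identityˡ 1#
    1²·1²≡1 : (1# * 1#) * (1# * 1#) ≡ 1#
    1²·1²≡1 = trans (cong₂ _*_ 1·1≡1 1·1≡1) 1·1≡1
    scale-1·1 : ∀ P → scale (1# * 1#) P ≋ P
    scale-1·1 P = ≋-trans (scale-cong 1·1≡1 (≋-refl {P})) (scale-identity P)

  ⇝-swap : ∀ f → f ⇝ form (C f) (B f) (A f)
  ⇝-swap f = transform swap (- 1#) -1·-1≡1 det-swap (∘ₘ-swap f)

  ⇝-negate-B : ∀ g → g ⇝ form (A g) (neg (B g)) (C g)
  ⇝-negate-B g = ⇝-≋F (⇝-diagonal g 1# (- 1#) [1·-1]²≡1)
    (mk≋F (scale-≡1 (A g) (*-identityˡ 1#)) (scale-≡-1 (B g) 1·-1≡-1) (scale-≡1 (C g) -1·-1≡1))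
    where
    1·-1≡-1 : 1# * - 1# ≡ - 1#
    1·-1≡-1 = *-identityˡ (- 1#)
    [1·-1]²≡1 : (1# * - 1#) * (1# * - 1#) ≡ 1#
    [1·-1]²≡1 = trans (cong₂ _*_ 1·-1≡-1 1·-1≡-1) -1·-1≡1

  ⇝-translation : ∀ f k → f ⇝ form (A f) (B f ⊕ scale two (A f) ⊗ k) (C f ⊕ B f ⊗ k ⊕ A f ⊗ k ⊗ k)
  ⇝-translation f k = transform (translation k) 1# (*-identityˡ 1#) (det-translation k) (∘ₘ-translation f k)

  ⇝-constant : ∀ f α β γ δ → α * δ + - (β * γ) ≡ 1# → f ⇝ f ∘ₘ constant α β γ δ
  ⇝-constant f α β γ δ det≡1 = transform (constant α β γ δ) 1# (*-identityˡ 1#)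
    (≋-trans (det-constant α β γ δ) (∷-cong det≡1 (≋-refl {[]}))) (mk≋F ≋-refl ≋-refl ≋-refl)

  -- Counting in F_q

  index : Carrier → Fin q
  index x = Any.index (complete x)

  index-injective : ∀ {x y} → index x ≡ index y → x ≡ y
  index-injective = Membershipₚ.index-injective (setoid Carrier) (complete _) (complete _)

  All-lookup : ∀ {P : Carrier → Set} {xs} → All P xs → ∀ i → P (lookup xs i)
  All-lookup (p ∷ _)  Fin.zero    = p
  All-lookup (_ ∷ ps) (Fin.suc i) = All-lookup ps i

  lookup-injective : ∀ {xs : List Carrier} → Unique xs → ∀ i j → lookup xs i ≡ lookup xs j → i ≡ j
  lookup-injective (x∉ ∷ u) Fin.zero    Fin.zero    e = refl
  lookup-injective (x∉ ∷ u) Fin.zero    (Fin.suc j) e = ⊥-elim (All-lookup x∉ j e)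
  lookup-injective (x∉ ∷ u) (Fin.suc i) Fin.zero    e = ⊥-elim (All-lookup x∉ i (sym e))
  lookup-injective (x∉ ∷ u) (Fin.suc i) (Fin.suc j) e = cong Fin.suc (lookup-injective u i j e)

  injection⇒≤q : ∀ {k} (g : Fin k → Carrier) → (∀ i j → g i ≡ g j → i ≡ j) → k ℕ.≤ q
  injection⇒≤q g g-inj = Finₚ.injective⇒≤ (λ e → g-inj _ _ (index-injective e))

  injection⇒q≤ : ∀ {k} (g : Carrier → Fin k) → (∀ x y → g x ≡ g y → x ≡ y) → q ℕ.≤ k
  injection⇒q≤ g g-inj = Finₚ.injective⇒≤ (λ e → lookup-injective unique _ _ (g-inj _ _ e))

  pigeonhole : (g : ℕ → Carrier) → ∃[ i ] ∃[ j ] (i ℕ.< j × g i ≡ g j)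
  pigeonhole g with Finₚ.pigeonhole (ℕₚ.n<1+n q) (λ (i : Fin (suc q)) → index (g (toℕ i)))
  ... | i , j , i<j , e = toℕ i , toℕ j , i<j , index-injective e

  2≤q : 2 ℕ.≤ q
  2≤q = injection⇒≤q (λ { Fin.zero → 0# ; (Fin.suc _) → 1# }) 0-1-injective
    where
    0-1-injective : ∀ i j → _ → i ≡ j
    0-1-injective Fin.zero          Fin.zero          _ = refl
    0-1-injective Fin.zero          (Fin.suc Fin.zero) e = ⊥-elim (0≢1 e)
    0-1-injective (Fin.suc Fin.zero) Fin.zero          e = ⊥-elim (0≢1 (sym e))
    0-1-injective (Fin.suc Fin.zero) (Fin.suc Fin.zero) _ = refl

  Odd : ℕ → Set
  Odd m = ∃[ t ] (m ≡ suc (2 ℕ.* t))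

  odd-* : ∀ {m n} → Odd m → Odd n → Odd (m ℕ.* n)
  odd-* (s , refl) (t , refl) = s ℕ.+ (t ℕ.+ 2 ℕ.* (s ℕ.* t)) ,
    solve 2 (λ s t → (con 1 :+ con 2 :* s) :* (con 1 :+ con 2 :* t)
                   := con 1 :+ con 2 :* (s :+ (t :+ con 2 :* (s :* t)))) refl s t
    where open ℕSolver.+-*-Solver

  odd-^ : ∀ {p} → Odd p → ∀ k → Odd (p ^ k)
  odd-^ odd zero    = 0 , refl
  odd-^ odd (suc k) = odd-* odd (odd-^ odd k)

  prime-odd : ∀ {p} → Prime p → 3 ℕ.≤ p → Odd p
  prime-odd {p} p-prime 3≤p with p % 2 in p%2≡ | m%n<n p 2 | m≡m%n+[m/n]*n p 2
  ... | 0 | _ | _ = ⊥-elim (prime⇒¬composite p-prime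
                      (composite-≢ 2 {{_}} {{prime⇒nonZero p-prime}} (ℕₚ.<⇒≢ 3≤p) (m%n≡0⇒n∣m p 2 p%2≡)))
  ... | 1 | _ | p≡ = p / 2 , trans p≡ (cong suc (ℕₚ.*-comm (p / 2) 2))
  ... | suc (suc _) | s≤s (s≤s ()) | _

  q-odd : Odd q
  q-odd with char
  ... | p , k , p-prime , 5≤p , q≡pᵏ =
    subst Odd (sym q≡pᵏ) (odd-^ (prime-odd p-prime (ℕₚ.≤-trans (ℕₚ.m≤m+n 3 2) 5≤p)) k)

  3≤q : 3 ℕ.≤ q
  3≤q with ℕₚ.m≤n⇒m<n∨m≡n 2≤q
  ... | inj₁ 2<q = 2<q
  ... | inj₂ 2≡q = ⊥-elim (ℕₚ.even≢odd 1 (proj₁ q-odd) (trans 2≡q (proj₂ q-odd)))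

  k*2≡k+k : ∀ k → k ℕ.* 2 ≡ k ℕ.+ k
  k*2≡k+k k = trans (ℕₚ.*-comm k 2) (cong (k ℕ.+_) (ℕₚ.+-identityʳ k))

  pow-+ : ∀ x i j → pow x (i ℕ.+ j) ≡ pow x i * pow x j
  pow-+ x zero    j = sym (*-identityˡ _)
  pow-+ x (suc i) j = trans (cong (x *_) (pow-+ x i j)) (sym (*-assoc x _ _))

  pow-* : ∀ x i j → pow x (i ℕ.* j) ≡ pow (pow x i) j
  pow-* x i zero    = cong (pow x) (ℕₚ.*-zeroʳ i)
  pow-* x i (suc j) =
    trans (cong (pow x) (ℕₚ.*-suc i j)) (trans (pow-+ x i (i ℕ.* j)) (cong (pow x i *_) (pow-* x i j)))

  pow-1# : ∀ i → pow 1# i ≡ 1#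
  pow-1# zero    = refl
  pow-1# (suc i) = trans (*-identityˡ _) (pow-1# i)

  pow-nonzero : ∀ {x} → x ≢ 0# → ∀ i → pow x i ≢ 0#
  pow-nonzero x≢0 zero    = λ 1≡0 → 0≢1 (sym 1≡0)
  pow-nonzero x≢0 (suc i) = *-nonzero x≢0 (pow-nonzero x≢0 i)

  pow-∸ : ∀ {x} → x ≢ 0# → ∀ {i j} → i ℕ.≤ j → pow x i ≡ pow x j → pow x (j ∸ i) ≡ 1#
  pow-∸ {x} x≢0 {i} {j} i≤j e = sym (*-cancelˡ (pow-nonzero x≢0 i) (begin
    pow x i * 1#                ≡⟨ *-identityʳ _ ⟩
    pow x i                     ≡⟨ e ⟩
    pow x j                     ≡⟨ cong (pow x) (ℕₚ.m+[n∸m]≡n i≤j) ⟨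
    pow x (i ℕ.+ (j ∸ i))       ≡⟨ pow-+ x i (j ∸ i) ⟩
    pow x i * pow x (j ∸ i)     ∎))
    where open ≡-Reasoning

  record Order (x : Carrier) (n : ℕ) : Set where
    field
      positive : 0 ℕ.< n
      pow≡1    : pow x n ≡ 1#
      minimal  : ∀ j → 0 ℕ.< j → j ℕ.< n → pow x j ≢ 1#

  order-≤-or-none : ∀ x k → (∃[ n ] (n ℕ.≤ k × Order x n)) ⊎ (∀ j → 0 ℕ.< j → j ℕ.≤ k → pow x j ≢ 1#)
  order-≤-or-none x zero = inj₂ λ j 0<j j≤0 → ⊥-elim (ℕₚ.<⇒≱ 0<j j≤0)
  order-≤-or-none x (suc k) with order-≤-or-none x k
  ... | inj₁ (n , n≤k , ord) = inj₁ (n , ℕₚ.m≤n⇒m≤1+n n≤k , ord)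
  ... | inj₂ none with pow x (suc k) ≟ 1#
  ...   | yes xᵏ⁺¹≡1 = inj₁ (suc k , ℕₚ.≤-refl ,
          record { positive = s≤s z≤n ; pow≡1 = xᵏ⁺¹≡1 ; minimal = λ j 0<j j<k+1 → none j 0<j (ℕₚ.≤-pred j<k+1) })
  ...   | no  xᵏ⁺¹≢1 = inj₂ λ j 0<j j≤k+1 → case-≤ j 0<j (ℕₚ.m≤n⇒m<n∨m≡n j≤k+1)
    where
    case-≤ : ∀ j → 0 ℕ.< j → j ℕ.< suc k ⊎ j ≡ suc k → pow x j ≢ 1#
    case-≤ j 0<j (inj₁ j<k+1) = none j 0<j (ℕₚ.≤-pred j<k+1)
    case-≤ j 0<j (inj₂ refl)  = xᵏ⁺¹≢1

  order : ∀ {x} → x ≢ 0# → ∃[ n ] Order x n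
  order {x} x≢0 with pigeonhole (pow x)
  ... | i , j , i<j , e with order-≤-or-none x (j ∸ i)
  ... | inj₁ (n , _ , ord) = n , ord
  ... | inj₂ none = ⊥-elim (none (j ∸ i) (ℕₚ.m<n⇒0<n∸m i<j) ℕₚ.≤-refl (pow-∸ x≢0 (ℕₚ.<⇒≤ i<j) e))

  IsSquare? : ∀ a → Dec (IsSquare a)
  IsSquare? a with Any.any? (λ y → (y * y) ≟ a) elements
  ... | yes some = yes (Any.satisfied some)
  ... | no  none = no λ (y , y²≡a) → none (Any.map (λ y≡x → subst (λ x → x * x ≡ a) y≡x y²≡a) (complete y))

  embed : ℕ → Carrier
  embed zero    = 0#
  embed (suc k) = 1# + embed k

  embed-+ : ∀ i j → embed (i ℕ.+ j) ≡ embed i + embed j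
  embed-+ zero    j = sym (+-identityˡ _)
  embed-+ (suc i) j = trans (cong (1# +_) (embed-+ i j)) (sym (+-assoc _ _ _))

  embed≡-1 : ∃[ N ] (embed N ≡ - 1#)
  embed≡-1 with pigeonhole embed
  ... | i , j , i<j , e with j ∸ i | ℕₚ.m<n⇒0<n∸m i<j | ℕₚ.m+[n∸m]≡n (ℕₚ.<⇒≤ i<j)
  ... | suc N | _ | i+[j∸i]≡j = N , +-inverseˡ-unique (embed N) 1# (trans (+-comm _ 1#) 1+N≡0)
    where
    1+N≡0 : embed (suc N) ≡ 0#
    1+N≡0 = +-cancelˡ (embed i) _ _ (begin
      embed i + embed (suc N)   ≡⟨ embed-+ i (suc N) ⟨
      embed (i ℕ.+ suc N)       ≡⟨ cong embed i+[j∸i]≡j ⟩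
      embed j                   ≡⟨ e ⟨
      embed i                   ≡⟨ +-identityʳ _ ⟨
      embed i + 0#              ∎)
      where open ≡-Reasoning

  -- walking up 0, 1, 2, …, N = -1 from a square to a non-square, some k is a
  -- square while k + 1 = 1² + k is not
  abstract
    nonsquare-sum-of-squares : ¬ IsSquare (- 1#) → ∃[ x ] ∃[ y ] ¬ IsSquare (x * x + y * y)
    nonsquare-sum-of-squares -1-nonsquare = walk N 0 refl (0# , zeroˡ 0#)
      where
      N : ℕ
      N = proj₁ embed≡-1
      walk : ∀ m k → k ℕ.+ m ≡ N → IsSquare (embed k) → ∃[ x ] ∃[ y ] ¬ IsSquare (x * x + y * y)
      walk zero    k k+0≡N k-square = ⊥-elim (-1-nonsquare
        (subst IsSquare (trans (cong embed (trans (sym (ℕₚ.+-identityʳ k)) k+0≡N)) (proj₂ embed≡-1)) k-square))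
      walk (suc m) k k+m+1≡N (z , z²≡k) with IsSquare? (embed (suc k))
      ... | yes k+1-square   = walk m (suc k) (trans (sym (ℕₚ.+-suc k m)) k+m+1≡N) k+1-square
      ... | no  k+1-nonsquare = 1# , z , λ sq → k+1-nonsquare (subst IsSquare (cong₂ _+_ (*-identityˡ 1#) z²≡k) sq)

  -- Powers of a primitive root

  module PrimitiveRoot (h : Carrier) (h-primitive : IsPrimitiveRoot h) where

    h≢0 : h ≢ 0#
    h≢0 h≡0 = ℕₚ.<⇒≱ 3≤q (injection⇒q≤ (λ x → zero-or-one x (x ≟ 0#)) zero-or-one-injective)
      where
      nonzero⇒≡1 : ∀ {x} → x ≢ 0# → x ≡ 1#
      nonzero⇒≡1 {x} x≢0 with h-primitive x x≢0
      ... | zero  , 1≡x    = sym 1≡x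
      ... | suc i , hⁱ⁺¹≡x = ⊥-elim (x≢0 (trans (sym hⁱ⁺¹≡x) (trans (cong (_* pow h i) h≡0) (zeroˡ _))))
      zero-or-one : ∀ x → Dec (x ≡ 0#) → Fin 2
      zero-or-one x (yes _) = Fin.zero
      zero-or-one x (no  _) = Fin.suc Fin.zero
      zero-or-one-injective : ∀ x y → zero-or-one x (x ≟ 0#) ≡ zero-or-one y (y ≟ 0#) → x ≡ y
      zero-or-one-injective x y e with x ≟ 0# | y ≟ 0# | e
      ... | yes x≡0 | yes y≡0 | _ = trans x≡0 (sym y≡0)
      ... | no  x≢0 | no  y≢0 | _ = trans (nonzero⇒≡1 x≢0) (sym (nonzero⇒≡1 y≢0))
      ... | yes _   | no  _   | ()
      ... | no  _   | yes _   | ()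

    n : ℕ
    n = proj₁ (order h≢0)

    open Order (proj₂ (order h≢0))

    instance
      n-nonZero : NonZero n
      n-nonZero = ℕ.>-nonZero positive

    pow-% : ∀ i → pow h i ≡ pow h (i % n)
    pow-% i = begin
      pow h i                                  ≡⟨ cong (pow h) (m≡m%n+[m/n]*n i n) ⟩
      pow h (i % n ℕ.+ (i / n) ℕ.* n)          ≡⟨ pow-+ h (i % n) _ ⟩
      pow h (i % n) * pow h ((i / n) ℕ.* n)    ≡⟨ cong (λ k → pow h (i % n) * pow h k) (ℕₚ.*-comm (i / n) n) ⟩
      pow h (i % n) * pow h (n ℕ.* (i / n))    ≡⟨ cong (pow h (i % n) *_) (trans (pow-* h n (i / n)) (trans (cong (λ y → pow y (i / n)) pow≡1) (pow-1# (i / n)))) ⟩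
      pow h (i % n) * 1#                       ≡⟨ *-identityʳ _ ⟩
      pow h (i % n)                            ∎
      where open ≡-Reasoning

    log : ∀ a → a ≢ 0# → ∃[ e ] (e ℕ.< n × pow h e ≡ a)
    log a a≢0 with h-primitive a a≢0
    ... | i , hⁱ≡a = i % n , m%n<n i n , trans (sym (pow-% i)) hⁱ≡a

    pow-injective : ∀ {i j} → i ℕ.< n → j ℕ.< n → pow h i ≡ pow h j → i ≡ j
    pow-injective {i} {j} i<n j<n e with ℕₚ.<-cmp i j
    ... | tri< i<j _ _ = ⊥-elim (minimal (j ∸ i) (ℕₚ.m<n⇒0<n∸m i<j) (ℕₚ.≤-<-trans (ℕₚ.m∸n≤m j i) j<n) (pow-∸ h≢0 (ℕₚ.<⇒≤ i<j) e))
    ... | tri≈ _ i≡j _ = i≡j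
    ... | tri> _ _ j<i = ⊥-elim (minimal (i ∸ j) (ℕₚ.m<n⇒0<n∸m j<i) (ℕₚ.≤-<-trans (ℕₚ.m∸n≤m i j) i<n) (pow-∸ h≢0 (ℕₚ.<⇒≤ j<i) (sym e)))

    q≡1+n : q ≡ suc n
    q≡1+n = ℕₚ.≤-antisym (injection⇒q≤ (λ x → encode x (x ≟ 0#)) encode-injective)
                         (injection⇒≤q decode decode-injective)
      where
      encode : ∀ x → Dec (x ≡ 0#) → Fin (suc n)
      encode x (yes _)   = Fin.zero
      encode x (no  x≢0) = Fin.suc (fromℕ< (proj₁ (proj₂ (log x x≢0))))
      encode-injective : ∀ x y → encode x (x ≟ 0#) ≡ encode y (y ≟ 0#) → x ≡ y
      encode-injective x y e with x ≟ 0# | y ≟ 0# | e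
      ... | yes x≡0 | yes y≡0 | _ = trans x≡0 (sym y≡0)
      ... | yes _   | no  _   | ()
      ... | no  _   | yes _   | ()
      ... | no  x≢0 | no  y≢0 | e′ =
        trans (sym (proj₂ (proj₂ (log x x≢0)))) (trans (cong (pow h) logx≡logy) (proj₂ (proj₂ (log y y≢0))))
        where
        logx≡logy : proj₁ (log x x≢0) ≡ proj₁ (log y y≢0)
        logx≡logy = trans (sym (Finₚ.toℕ-fromℕ< _)) (trans (cong toℕ (Finₚ.suc-injective e′)) (Finₚ.toℕ-fromℕ< _))
      decode : Fin (suc n) → Carrier
      decode Fin.zero    = 0#
      decode (Fin.suc i) = pow h (toℕ i)
      decode-injective : ∀ i j → decode i ≡ decode j → i ≡ j
      decode-injective Fin.zero    Fin.zero    _ = refl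
      decode-injective Fin.zero    (Fin.suc j) e = ⊥-elim (pow-nonzero h≢0 (toℕ j) (sym e))
      decode-injective (Fin.suc i) Fin.zero    e = ⊥-elim (pow-nonzero h≢0 (toℕ i) e)
      decode-injective (Fin.suc i) (Fin.suc j) e =
        cong Fin.suc (Finₚ.toℕ-injective (pow-injective (Finₚ.toℕ<n i) (Finₚ.toℕ<n j) e))

    t : ℕ
    t = proj₁ q-odd

    n≡2t : n ≡ 2 ℕ.* t
    n≡2t = ℕₚ.suc-injective (trans (sym q≡1+n) (proj₂ q-odd))

    0<t : 0 ℕ.< t
    0<t = ℕₚ.n≢0⇒n>0 λ t≡0 → ℕₚ.<⇒≢ positive (sym (trans n≡2t (cong (2 ℕ.*_) t≡0)))

    t<n : t ℕ.< n
    t<n = subst (t ℕ.<_) (sym n≡2t) (ℕₚ.m<m+n t (ℕₚ.<-≤-trans 0<t (ℕₚ.m≤m+n t 0)))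

    [q∸3]/2≡pred[t] : (q ∸ 3) / 2 ≡ ℕ.pred t
    [q∸3]/2≡pred[t] = begin
      (q ∸ 3) / 2              ≡⟨ cong (λ k → (k ∸ 3) / 2) (proj₂ q-odd) ⟩
      (2 ℕ.* t ∸ 2) / 2        ≡⟨ cong (λ k → (k ∸ 2) / 2) (ℕₚ.*-comm 2 t) ⟩
      (t ℕ.* 2 ∸ 1 ℕ.* 2) / 2  ≡⟨ cong (_/ 2) (ℕₚ.*-distribʳ-∸ 2 t 1) ⟨
      ((t ∸ 1) ℕ.* 2) / 2      ≡⟨ m*n/n≡m (t ∸ 1) 2 ⟩
      t ∸ 1                    ≡⟨ m∸1≡pred[m] t ⟩
      ℕ.pred t                 ∎
      where
      open ≡-Reasoning
      m∸1≡pred[m] : ∀ m → m ∸ 1 ≡ ℕ.pred m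
      m∸1≡pred[m] zero    = refl
      m∸1≡pred[m] (suc m) = refl

    <t⇒InS : ∀ {i a} → i ℕ.< t → pow h i ≡ a → InS h a
    <t⇒InS {i} i<t hⁱ≡a = i , subst (i ℕ.≤_) (sym [q∸3]/2≡pred[t]) (ℕₚ.<⇒≤pred i<t) , hⁱ≡a

    hᵗ*hᵗ≡1 : pow h t * pow h t ≡ 1#
    hᵗ*hᵗ≡1 = trans (sym (pow-+ h t t))
      (trans (cong (pow h) (trans (cong (t ℕ.+_) (sym (ℕₚ.+-identityʳ t))) (sym n≡2t))) pow≡1)

    hᵗ≡-1 : pow h t ≡ - 1#
    hᵗ≡-1 with square≡1 (pow h t) hᵗ*hᵗ≡1
    ... | inj₁ hᵗ≡1  = ⊥-elim (minimal t 0<t t<n hᵗ≡1)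
    ... | inj₂ hᵗ≡-1 = hᵗ≡-1

    two≢0 : two ≢ 0#
    two≢0 1+1≡0 = minimal t 0<t t<n (trans hᵗ≡-1 (sym (+-inverseˡ-unique 1# 1# 1+1≡0)))

    sign : ∀ a → a ≢ 0# → InS h a ⊎ InS h (- a)
    sign a a≢0 with log a a≢0
    ... | e , e<n , hᵉ≡a with e ℕ.<? t
    ...   | yes e<t = inj₁ (<t⇒InS e<t hᵉ≡a)
    ...   | no  e≮t = inj₂ (<t⇒InS r<t hʳ≡-a)
      where
      r = e ∸ t
      t+r≡e : t ℕ.+ r ≡ e
      t+r≡e = ℕₚ.m+[n∸m]≡n (ℕₚ.≮⇒≥ e≮t)
      r<t : r ℕ.< t
      r<t = ℕₚ.+-cancelˡ-< t r t (subst₂ ℕ._<_ (sym t+r≡e) (trans n≡2t (cong (t ℕ.+_) (ℕₚ.+-identityʳ t))) e<n)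
      hʳ≡-a : pow h r ≡ - a
      hʳ≡-a = begin
        pow h r                 ≡⟨ -‿involutive (pow h r) ⟨
        - (- pow h r)           ≡⟨ cong -_ (-1*x≈-x (pow h r)) ⟨
        - (- 1# * pow h r)      ≡⟨ cong (λ x → - (x * pow h r)) hᵗ≡-1 ⟨
        - (pow h t * pow h r)   ≡⟨ cong -_ (pow-+ h t r) ⟨
        - pow h (t ℕ.+ r)       ≡⟨ cong (λ k → - pow h k) t+r≡e ⟩
        - pow h e               ≡⟨ cong -_ hᵉ≡a ⟩
        - a                     ∎
        where open ≡-Reasoning

    abstract
      square-or-h·square : ∀ a → a ≢ 0# → ∃[ w ] (w ≢ 0# × (a ≡ w * w ⊎ a ≡ h * (w * w)))
      square-or-h·square a a≢0 with h-primitive a a≢0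
      ... | i , hⁱ≡a = pow h k , pow-nonzero h≢0 k , by-parity (i % 2) (m%n<n i 2) (m≡m%n+[m/n]*n i 2)
        where
        k : ℕ
        k = i / 2
        hᵏ⁺ᵏ≡hᵏhᵏ : pow h (k ℕ.+ k) ≡ pow h k * pow h k
        hᵏ⁺ᵏ≡hᵏhᵏ = pow-+ h k k
        by-parity : ∀ r → r ℕ.< 2 → i ≡ r ℕ.+ k ℕ.* 2 → a ≡ pow h k * pow h k ⊎ a ≡ h * (pow h k * pow h k)
        by-parity 0 _ i≡2k   = inj₁ (trans (sym hⁱ≡a) (trans (cong (pow h) (trans i≡2k (k*2≡k+k k))) hᵏ⁺ᵏ≡hᵏhᵏ))
        by-parity 1 _ i≡2k+1 = inj₂ (trans (sym hⁱ≡a) (trans (cong (pow h) (trans i≡2k+1 (cong suc (k*2≡k+k k))))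
                                 (cong (h *_) hᵏ⁺ᵏ≡hᵏhᵏ)))
        by-parity (suc (suc _)) (s≤s (s≤s ())) _

    nonsquare⇒h·square : ∀ {b} → b ≢ 0# → ¬ IsSquare b → ∃[ z ] (z ≢ 0# × b ≡ h * (z * z))
    nonsquare⇒h·square {b} b≢0 b-nonsquare with square-or-h·square b b≢0
    ... | z , z≢0 , inj₁ b≡z²  = ⊥-elim (b-nonsquare (z , sym b≡z²))
    ... | z , z≢0 , inj₂ b≡hz² = z , z≢0 , b≡hz²

    -1-nonsquare : ∀ {a c w v} → a ≡ h * (w * w) → c ≡ h * (v * v) → ¬ IsSquare (- (a * c)) → ¬ IsSquare (- 1#)
    -1-nonsquare {a} {c} {w} {v} a≡hw² c≡hv² -ac-nonsquare (r , r²≡-1) = -ac-nonsquare (r * (h * (w * v)) , (begin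
      (r * (h * (w * v))) * (r * (h * (w * v)))
        ≡⟨ solve 4 (λ r h w v → ((r :* (h :* (w :* v))) :* (r :* (h :* (w :* v)))) := ((r :* r) :* ((h :* (w :* w)) :* (h :* (v :* v))))) refl r h w v ⟩
      (r * r) * ((h * (w * w)) * (h * (v * v)))
        ≡⟨ cong₂ _*_ r²≡-1 (cong₂ _*_ (sym a≡hw²) (sym c≡hv²)) ⟩
      - 1# * (a * c)
        ≡⟨ -1*x≈-x (a * c) ⟩
      - (a * c) ∎))
      where
      open ≡-Reasoning
      open FieldSolver using (solve; _:=_; _:*_)

    -- x² + y² = h z² gives a (xv)² + c (yw)² = (h w v z)²
    represents-square-h·squares : ∀ {a c w v} → w ≢ 0# → v ≢ 0# → a ≡ h * (w * w) → c ≡ h * (v * v) →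
      ¬ IsSquare (- 1#) → ∃[ α ] ∃[ γ ] ∃[ u ] (u ≢ 0# × (α * α) * a + (γ * γ) * c ≡ u * u)
    represents-square-h·squares {a} {c} {w} {v} w≢0 v≢0 a≡hw² c≡hv² -1-nonsq =
      let x , y , x²+y²-nonsquare = nonsquare-sum-of-squares -1-nonsq
          x²+y²≢0 = λ x²+y²≡0 → x²+y²-nonsquare (0# , trans (zeroˡ 0#) (sym x²+y²≡0))
          z , z≢0 , x²+y²≡hz² = nonsquare⇒h·square x²+y²≢0 x²+y²-nonsquare
      in  x * v , y * w , h * (w * (v * z)) , *-nonzero h≢0 (*-nonzero w≢0 (*-nonzero v≢0 z≢0)) , (begin
        ((x * v) * (x * v)) * a + ((y * w) * (y * w)) * c
          ≡⟨ cong₂ (λ a c → ((x * v) * (x * v)) * a + ((y * w) * (y * w)) * c) a≡hw² c≡hv² ⟩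
        ((x * v) * (x * v)) * (h * (w * w)) + ((y * w) * (y * w)) * (h * (v * v))
          ≡⟨ solve 5 (λ x y h w v → ((((x :* v) :* (x :* v)) :* (h :* (w :* w))) :+ (((y :* w) :* (y :* w)) :* (h :* (v :* v))))
                                    := ((h :* ((w :* w) :* (v :* v))) :* ((x :* x) :+ (y :* y)))) refl x y h w v ⟩
        (h * ((w * w) * (v * v))) * (x * x + y * y)
          ≡⟨ cong ((h * ((w * w) * (v * v))) *_) x²+y²≡hz² ⟩
        (h * ((w * w) * (v * v))) * (h * (z * z))
          ≡⟨ solve 4 (λ h w v z → ((h :* ((w :* w) :* (v :* v))) :* (h :* (z :* z))) := ((h :* (w :* (v :* z))) :* (h :* (w :* (v :* z))))) refl h w v z ⟩
        (h * (w * (v * z))) * (h * (w * (v * z))) ∎)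
      where
      open ≡-Reasoning
      open FieldSolver using (solve; _:=_; _:+_; _:*_)

    represents-square : ∀ {a c} → a ≢ 0# → c ≢ 0# → ¬ IsSquare (- (a * c)) →
                        ∃[ α ] ∃[ γ ] ∃[ u ] (u ≢ 0# × (α * α) * a + (γ * γ) * c ≡ u * u)
    represents-square {a} {c} a≢0 c≢0 -ac-nonsquare
      with square-or-h·square a a≢0 | square-or-h·square c c≢0
    ... | w , w≢0 , inj₁ a≡w² | _ = 1# , 0# , w , w≢0 , (begin
      (1# * 1#) * a + (0# * 0#) * c   ≡⟨ cong₂ _+_ (trans (cong (_* a) (*-identityˡ 1#)) (*-identityˡ a)) (trans (cong (_* c) (zeroˡ 0#)) (zeroˡ c)) ⟩
      a + 0#                          ≡⟨ trans (+-identityʳ a) a≡w² ⟩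
      w * w                           ∎)
      where open ≡-Reasoning
    ... | _ | v , v≢0 , inj₁ c≡v² = 0# , 1# , v , v≢0 , (begin
      (0# * 0#) * a + (1# * 1#) * c   ≡⟨ cong₂ _+_ (trans (cong (_* a) (zeroˡ 0#)) (zeroˡ a)) (trans (cong (_* c) (*-identityˡ 1#)) (*-identityˡ c)) ⟩
      0# + c                          ≡⟨ trans (+-identityˡ c) c≡v² ⟩
      v * v                           ∎)
      where open ≡-Reasoning
    ... | w , w≢0 , inj₂ a≡hw² | v , v≢0 , inj₂ c≡hv² =
      represents-square-h·squares w≢0 v≢0 a≡hw² c≡hv² (-1-nonsquare a≡hw² c≡hv² -ac-nonsquare)

    represents-one : ∀ {a c} → a ≢ 0# → c ≢ 0# → ¬ IsSquare (- (a * c)) →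
                     ∃[ α ] ∃[ γ ] ((α * α) * a + (γ * γ) * c ≡ 1#)
    represents-one a≢0 c≢0 -ac-nonsquare =
      let α , γ , u , u≢0 , rep = represents-square a≢0 c≢0 -ac-nonsquare
      in  α * inv u u≢0 , γ * inv u u≢0 , rescale-to-one u≢0 rep

    normalise-lead : ∀ {a w} (w≢0 : w ≢ 0#) → a ≡ w * w ⊎ a ≡ h * (w * w) →
                     (inv w w≢0 * inv w w≢0) * a ≡ 1# ⊎ (inv w w≢0 * inv w w≢0) * a ≡ h
    normalise-lead {w = w} w≢0 (inj₁ a≡w²) = inj₁ (trans (cong ((inv w w≢0 * inv w w≢0) *_) a≡w²) ([x⁻¹x⁻¹][xx]≡1 w w≢0))
    normalise-lead {a} {w} w≢0 (inj₂ a≡hw²) = inj₂ (begin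
      (w⁻¹ * w⁻¹) * a             ≡⟨ cong ((w⁻¹ * w⁻¹) *_) a≡hw² ⟩
      (w⁻¹ * w⁻¹) * (h * (w * w)) ≡⟨ solve 3 (λ w⁻¹ h w → ((w⁻¹ :* w⁻¹) :* (h :* (w :* w))) := (h :* ((w⁻¹ :* w⁻¹) :* (w :* w)))) refl w⁻¹ h w ⟩
      h * ((w⁻¹ * w⁻¹) * (w * w)) ≡⟨ cong (h *_) ([x⁻¹x⁻¹][xx]≡1 w w≢0) ⟩
      h * 1#                      ≡⟨ *-identityʳ h ⟩
      h                           ∎)
      where
      open ≡-Reasoning
      open FieldSolver using (solve; _:=_; _:*_)
      w⁻¹ = inv w w≢0

  -- The reduction

  -- all that the reduction uses of D being imaginary or unusual
  record NonSplit (D : Poly) : Set where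
    field
      nonzero             : ¬ D ≋ []
      even-lead-nonsquare : ∀ {m c} → HasLead D (m ℕ.+ m) c → ¬ IsSquare c

  record Reduced (g : Form) : Set where
    constructor reduced
    field
      {dA dC} : ℕ
      {a c}   : Carrier
      lead-A  : HasLead (A g) dA a
      bound-B : Bounded (B g) dA
      lead-C  : HasLead (C g) dC c
      dA≤dC   : dA ℕ.≤ dC

  module Reduction (h : Carrier) (h-primitive : IsPrimitiveRoot h) {D : Poly} (D-nonsplit : NonSplit D) where
    open PrimitiveRoot h h-primitive
    open NonSplit D-nonsplit

    four≢0 : four ≢ 0#
    four≢0 4≡0 = *-nonzero two≢0 two≢0 (trans (sym four≡two·two) 4≡0)

    A⊗C≉0 : ∀ g → disc g ≋ D → ¬ (A g ⊗ C g ≋ [])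
    A⊗C≉0 (form A B C) disc≋D AC≋0 with zero-or-lead B
    ... | inj₁ B≋0 = nonzero (≋-trans (≋-sym disc≋D) (≋-trans (disc-≋-B² {A} {B} {C} AC≋0) (⊗-zeroˡ B B≋0)))
    ... | inj₂ (dB , b , lB) =
      even-lead-nonsquare {dB} (lead-≋ (≋-trans (≋-sym (disc-≋-B² {A} {B} {C} AC≋0)) disc≋D) (lead-⊗ lB lB)) (b , refl)

    A-has-lead : ∀ g → disc g ≋ D → ∃[ d ] ∃[ a ] HasLead (A g) d a
    A-has-lead g disc≋D with zero-or-lead (A g)
    ... | inj₁ A≋0 = ⊥-elim (A⊗C≉0 g disc≋D (⊗-zeroˡ (C g) A≋0))
    ... | inj₂ lA  = lA

    C-has-lead : ∀ g → disc g ≋ D → ∃[ e ] ∃[ c ] HasLead (C g) e c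
    C-has-lead g disc≋D with zero-or-lead (C g)
    ... | inj₁ C≋0 = ⊥-elim (A⊗C≉0 g disc≋D (≋-trans (⊗-comm (A g) (C g)) (⊗-zeroˡ (A g) C≋0)))
    ... | inj₂ lC  = lC

    opaque
      reduce-B : ∀ g {d a} → HasLead (A g) d a → ∃[ g′ ] (g ⇝ g′ × A g′ ≡ A g × Bounded (B g′) d)
      reduce-B g lA =
        let k , bounded = division (lead-scale two two≢0 lA) (B g)
        in  _ , ⇝-translation g k , refl , bounded

    -- translate to make deg B < deg A; while deg C < deg A, swap A and C and repeat
    reduce-from : ∀ fuel g {d a} → disc g ≋ D → HasLead (A g) d a → d ℕ.< fuel → ∃[ g′ ] (g ⇝ g′ × Reduced g′)
    swap-if-needed : ∀ fuel g {d e a c} → disc g ≋ D → HasLead (A g) d a → Bounded (B g) d → HasLead (C g) e c →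
                     d ℕ.≤ fuel → Dec (d ℕ.≤ e) → ∃[ g′ ] (g ⇝ g′ × Reduced g′)

    reduce-from (suc fuel) g {d} disc≋D lA d<fuel =
      let g₁ , g⇝g₁ , A₁≡A , bB₁ = reduce-B g lA
          disc₁≋D = ≋-trans (⇝-disc g⇝g₁) disc≋D
          e , c , lC₁ = C-has-lead g₁ disc₁≋D
          lA₁ = subst (λ P → HasLead P d _) (sym A₁≡A) lA
      in  ⇝-∃-trans g⇝g₁ (swap-if-needed fuel g₁ disc₁≋D lA₁ bB₁ lC₁ (ℕₚ.≤-pred d<fuel) (d ℕ.≤? e))

    swap-if-needed fuel g disc≋D lA bB lC d≤fuel (yes d≤e) = g , ⇝-refl g , reduced lA bB lC d≤e
    swap-if-needed fuel g disc≋D lA bB lC d≤fuel (no  d≰e) =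
      ⇝-∃-trans (⇝-swap g) (reduce-from fuel (form (C g) (B g) (A g))
        (≋-trans (⇝-disc (⇝-swap g)) disc≋D) lC (ℕₚ.<-≤-trans (ℕₚ.≰⇒> d≰e) d≤fuel))

    opaque
      reduce : ∀ g → disc g ≋ D → ∃[ g′ ] (g ⇝ g′ × Reduced g′)
      reduce g disc≋D =
        let d , a , lA = A-has-lead g disc≋D
        in  reduce-from (suc d) g disc≋D lA (ℕₚ.n<1+n d)

    record Normalised (g : Form) : Set where
      field
        shape         : Reduced g
        sgn-A         : Reduced.a shape ≡ 1# ⊎ Reduced.a shape ≡ h
        sgn-A-if-same : Reduced.dA shape ≡ Reduced.dC shape → Reduced.a shape ≡ 1#

    normalise-distinct : ∀ {g} (r : Reduced g) → Reduced.dA r ℕ.< Reduced.dC r → ∃[ g′ ] (g ⇝ g′ × Normalised g′)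
    normalise-distinct {g} (reduced {a = a} lA bB lC dA≤dC) dA<dC =
      let w , w≢0 , a-class = square-or-h·square a (lead-nonzero lA)
          w⁻¹ = inv w w≢0
          w⁻¹≢0 = inv-nonzero w w≢0
      in  _ , ⇝-diagonal g w⁻¹ w (trans (cong₂ _*_ (*-inverseˡ w w≢0) (*-inverseˡ w w≢0)) (*-identityˡ 1#)) ,
          record
            { shape = reduced (lead-scale (w⁻¹ * w⁻¹) (*-nonzero w⁻¹≢0 w⁻¹≢0) lA) (bounded-scale (w⁻¹ * w) bB)
                              (lead-scale (w * w) (*-nonzero w≢0 w≢0) lC) dA≤dC
            ; sgn-A = normalise-lead w≢0 a-class
            ; sgn-A-if-same = λ dA≡dC → ⊥-elim (ℕₚ.<⇒≢ dA<dC dA≡dC)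
            }

    lead-disc-equal : ∀ {g d a c} → disc g ≋ D → HasLead (A g) d a → Bounded (B g) d → HasLead (C g) d c →
                      HasLead D (d ℕ.+ d) (- (four * (a * c)))
    lead-disc-equal disc≋D lA bB lC = lead-≋ disc≋D (lead-disc four≢0 lA bB lC ℕₚ.≤-refl)

    opaque
      -- pick α, γ with lc(A) α² + lc(C) γ² = 1 and complete (α, γ) to a matrix of determinant 1
      lead-one : ∀ {g d a c} → disc g ≋ D → HasLead (A g) d a → Bounded (B g) d → HasLead (C g) d c →
                 ∃[ g′ ] (g ⇝ g′ × HasLead (A g′) d 1#)
      lead-one {g} {d} disc≋D lA bB lC =
        let -ac-nonsquare = -4x-nonsquare⇒-x-nonsquare (even-lead-nonsquare {d} (lead-disc-equal disc≋D lA bB lC))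
            α , γ , rep = represents-one (lead-nonzero lA) (lead-nonzero lC) -ac-nonsquare
            β , δ , det≡1 = unimodular-completion α γ (represents-one⇒nonzero α γ rep)
            lA′ = lead-combination (α * α) (α * γ) (γ * γ) lA bB lC (λ rep≡0 → 0≢1 (trans (sym rep≡0) rep))
        in  g ∘ₘ constant α β γ δ , ⇝-constant g α β γ δ det≡1 ,
            lead-≋ (≋-sym (A-∘ₘ-constant g α β γ δ)) (subst (HasLead _ d) rep lA′)

    normalise-equal : ∀ {g} → disc g ≋ D → (r : Reduced g) → Reduced.dA r ≡ Reduced.dC r → ∃[ g′ ] (g ⇝ g′ × Normalised g′)
    normalise-equal {g} disc≋D (reduced {dA = d} lA bB lC _) refl =
      let g₁ , g⇝g₁ , lA₁ = lead-one disc≋D lA bB lC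
          g₂ , g₁⇝g₂ , A₂≡A₁ , bB₂ = reduce-B g₁ lA₁
          lA₂ = subst (λ P → HasLead P d 1#) (sym A₂≡A₁) lA₁
          disc₂≋D = ≋-trans (⇝-disc g₁⇝g₂) (≋-trans (⇝-disc g⇝g₁) disc≋D)
          e , c , lC₂ = C-has-lead g₂ disc₂≋D
          d≤e = ℕₚ.≮⇒≥ λ e<d → ¬lead-bounded (lead-disc-equal disc≋D lA bB lC)
                                  (bounded-≋ disc₂≋D (bounded-disc lA₂ bB₂ lC₂ e<d))
      in  g₂ , ⇝-trans g⇝g₁ g₁⇝g₂ ,
          record { shape = reduced lA₂ bB₂ lC₂ d≤e ; sgn-A = inj₁ refl ; sgn-A-if-same = λ _ → refl }

    opaque
      normalise : ∀ {g} → disc g ≋ D → Reduced g → ∃[ g′ ] (g ⇝ g′ × Normalised g′)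
      normalise disc≋D r with ℕₚ.m≤n⇒m<n∨m≡n (Reduced.dA≤dC r)
      ... | inj₁ dA<dC = normalise-distinct r dA<dC
      ... | inj₂ dA≡dC = normalise-equal disc≋D r dA≡dC

    SignedB : Form → Set
    SignedB g = B g ≋ [] ⊎ ∃[ d ] ∃[ b ] (HasLead (B g) d b × InS h b)

    opaque
      sign-B : ∀ {g} → Normalised g → ∃[ g′ ] (g ⇝ g′ × Normalised g′ × SignedB g′)
      sign-B {g} n with zero-or-lead (B g)
      ... | inj₁ B≋0 = g , ⇝-refl g , n , inj₁ B≋0
      ... | inj₂ (dB , b , lB) with sign b (lead-nonzero lB)
      ...   | inj₁ b∈S  = g , ⇝-refl g , n , inj₂ (dB , b , lB , b∈S)
      ...   | inj₂ -b∈S = _ , ⇝-negate-B g , negated , inj₂ (dB , - b , lead-neg lB , -b∈S)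
        where
        open Normalised n
        open Reduced shape
        negated : Normalised (form (A g) (neg (B g)) (C g))
        negated = record
          { shape = reduced lead-A (bounded-neg bound-B) lead-C dA≤dC
          ; sgn-A = sgn-A
          ; sgn-A-if-same = sgn-A-if-same
          }

    Normalised-≋F : ∀ {g g′} → g ≋F g′ → Normalised g → Normalised g′
    Normalised-≋F g≋g′ n = record
      { shape = reduced (lead-≋ (A-≋ g≋g′) lead-A) (bounded-≋ (B-≋ g≋g′) bound-B) (lead-≋ (C-≋ g≋g′) lead-C) dA≤dC
      ; sgn-A = sgn-A
      ; sgn-A-if-same = sgn-A-if-same
      }
      where
      open Normalised n
      open Reduced shape

    SignedB-≋F : ∀ {g g′} → g ≋F g′ → SignedB g → SignedB g′
    SignedB-≋F g≋g′ (inj₁ B≋0) = inj₁ (≋-trans (≋-sym (B-≋ g≋g′)) B≋0)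
    SignedB-≋F g≋g′ (inj₂ (d , b , lB , b∈S)) = inj₂ (d , b , lead-≋ (B-≋ g≋g′) lB , b∈S)

    partially-reduced : ∀ {g} → Normalised g → SignedB g → PartiallyReduced h g
    partially-reduced {g} n signed =
      (∣B∣<∣A∣ signed , subst₂ ℕ._≤_ (sym (∣∣-lead lead-A)) (sym (∣∣-lead lead-C)) (ℕₚ.^-monoʳ-≤ q dA≤dC)) ,
      (λ _ → Data.Sum.map (trans (sgn-lead lead-A)) (trans (sgn-lead lead-A)) sgn-A) ,
      (λ ∣A∣≡∣C∣ → trans (sgn-lead lead-A) (sgn-A-if-same (qᵈ-injective (trans (sym (∣∣-lead lead-A)) (trans ∣A∣≡∣C∣ (∣∣-lead lead-C)))))) ,
      sgn-B signed
      where
      open Normalised n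
      open Reduced shape
      instance
        q-nonZero : NonZero q
        q-nonZero = ℕ.>-nonZero (ℕₚ.<-≤-trans (s≤s z≤n) 2≤q)
      qᵈ-injective : ∀ {d e} → q ^ d ≡ q ^ e → d ≡ e
      qᵈ-injective {d} {e} qᵈ≡qᵉ with ℕₚ.<-cmp d e
      ... | tri< d<e _ _ = ⊥-elim (ℕₚ.<⇒≢ (ℕₚ.^-monoʳ-< q 2≤q d<e) qᵈ≡qᵉ)
      ... | tri≈ _ d≡e _ = d≡e
      ... | tri> _ _ e<d = ⊥-elim (ℕₚ.<⇒≢ (ℕₚ.^-monoʳ-< q 2≤q e<d) (sym qᵈ≡qᵉ))
      ∣B∣<∣A∣ : SignedB g → ∣ B g ∣ ℕ.< ∣ A g ∣
      ∣B∣<∣A∣ (inj₁ B≋0) = subst₂ ℕ._<_ (sym (∣∣-zero B≋0)) (sym (∣∣-lead lead-A)) (ℕₚ.m^n>0 q dA)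
      ∣B∣<∣A∣ (inj₂ (dB , b , lB , _)) =
        subst₂ ℕ._<_ (sym (∣∣-lead lB)) (sym (∣∣-lead lead-A))
          (ℕₚ.^-monoʳ-< q 2≤q (ℕₚ.≰⇒> λ dA≤dB → ¬lead-bounded lB (bounded-mono dA≤dB bound-B)))
      sgn-B : SignedB g → ¬ (B g ≈ₚ []) → InS h (sgn (B g))
      sgn-B (inj₁ B≋0)               B≉0 = ⊥-elim (B≉0 (≋⇒≈ₚ B≋0))
      sgn-B (inj₂ (dB , b , lB , b∈S)) _  = subst (InS h) (sym (sgn-lead lB)) b∈S

  nonsplit : ∀ {D} → 1 ℕ.≤ deg D → Imaginary D ⊎ Unusual D → NonSplit D
  nonsplit {D} 1≤deg imaginary-or-unusual = record
    { nonzero = λ D≋0 → ℕₚ.<⇒≢ 1≤deg (sym (cong (λ P → length P ∸ 1) (norm-≋[] D≋0)))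
    ; even-lead-nonsquare = λ {m} → even-lead-nonsquare imaginary-or-unusual {m}
    }
    where
    even-lead-nonsquare : Imaginary D ⊎ Unusual D → ∀ {m c} → HasLead D (m ℕ.+ m) c → ¬ IsSquare c
    even-lead-nonsquare (inj₁ (k , deg≡2k+1)) {m} lD = ⊥-elim (ℕₚ.even≢odd m k
      (trans (cong (m ℕ.+_) (ℕₚ.+-identityʳ m)) (trans (sym (deg-lead lD)) deg≡2k+1)))
    even-lead-nonsquare (inj₂ (_ , _ , sgn-nonsquare)) lD = subst (λ c → ¬ IsSquare c) (sgn-lead lD) sgn-nonsquare

  partially-reduced-equivalent : ∀ h → IsPrimitiveRoot h → ∀ f → NonSplit (disc f) →
    ∃[ M ] (InGL2 M × PartiallyReduced h (f ∘ₘ M) × disc (f ∘ₘ M) ≈ₚ disc f)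
  partially-reduced-equivalent h h-primitive f D-nonsplit =
    let g₁ , f⇝g₁ , r = reduce f ≋-refl
        g₂ , g₁⇝g₂ , n = normalise (⇝-disc f⇝g₁) r
        g₃ , g₂⇝g₃ , n₃ , s₃ = sign-B n
        f⇝g₃ = ⇝-trans f⇝g₁ (⇝-trans g₁⇝g₂ g₂⇝g₃)
        open _⇝_ f⇝g₃
        unit≢0 = λ unit≡0 → 0≢1 (trans (sym (zeroˡ unit)) (trans (cong (_* unit) (sym unit≡0)) unit²))
    in  matrix , (unit , unit≢0 , ≋⇒≈ₚ det-matrix) ,
        partially-reduced (Normalised-≋F (≋F-sym result) n₃) (SignedB-≋F (≋F-sym result) s₃) ,
        ≋⇒≈ₚ (≋-trans (disc-cong result) (⇝-disc f⇝g₃))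
    where open Reduction h h-primitive D-nonsplit

proposition3p2 : (F : FiniteField) → let open FF F in
    (h : Carrier) → IsPrimitiveRoot h →
    (f : Form) →
    Primitive f → Irreducible f →
    1 ≤ deg (disc f) →
    (sgn (disc f) ≡ 1# ⊎ sgn (disc f) ≡ h) →
    (Imaginary (disc f) ⊎ Unusual (disc f)) →
    ∃[ M ] (InGL2 M × PartiallyReduced h (f ∘ₘ M) × disc (f ∘ₘ M) ≈ₚ disc f)
proposition3p2 F h h-primitive f _ _ 1≤deg _ imaginary-or-unusual =
  partially-reduced-equivalent F h h-primitive f (nonsplit F 1≤deg imaginary-or-unusual)
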